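{- Let $G=(V,E)$ be a $(p,\beta)$-jumbled graph of order $n$, where $p=p(n)$, $\beta=\beta(n)$ satisfy $\beta=o(np)$ as $n\to\infty$. Then $G$ contains an induced subgraph $G'$ of order $n'=(1-o(1))n$ such that every vertex of $G'$ has degree $(1+o(1))n'p$ in $G'$, and every subset $X\subseteq V(G')$ satisfies $$e(X,V(G')\setminus X)\ge (1-o(1))\,p\,|X|\,(n'-|X|).$$
   Context: All graphs are finite, simple. For $X\subseteq V$, $e(X)$ is the number of edges spanned by $X$, and for disjoint $X,Y$, $e(X,Y)$ is the number of edges between $X$ and $Y$. A graph $G=(V,E)$ is $(p,\beta)$-jumbled if $|e(X)-p|X|^2/2|\le\beta|X|$ for every $X\subseteq V$. Asymptotic notation refers to $n\to\infty$; each $o(1)$ denotes a quantity tending to $0$ (uniformly over vertices and sets $X$).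
   Formalization: The parameters p(n) and β(n) of the jumbledness condition take rational values. -}

module Defs where

open import Data.Nat using (ℕ; zero; suc) renaming (_+_ to _+ℕ_; _≤_ to _≤ℕ_; _∸_ to _∸ℕ_)
open import Data.Bool using (Bool; true; false; _∧_; not; if_then_else_)
open import Data.Fin using (Fin; zero; suc; _<?_)
open import Data.Integer using (+_)
open import Data.Rational using (ℚ; _/_; _*_; _-_; _+_; _≤_; _<_; ∣_∣; ½; 0ℚ; 1ℚ)
open import Relation.Nullary.Decidable using (⌊_⌋)
open import Relation.Binary.PropositionalEquality using (_≡_)
open import Data.Product using (Σ; _×_; ∃)

ℕ→ℚ : ℕ → ℚ
ℕ→ℚ n = + n / 1

record Graph (n : ℕ) : Set where
  field
    adj    : Fin n → Fin n → Bool
    sym    : ∀ i j → adj i j ≡ adj j i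
    irrefl : ∀ i → adj i i ≡ false
open Graph public

VSet : ℕ → Set
VSet n = Fin n → Bool

sumFin : ∀ {n} → (Fin n → ℕ) → ℕ
sumFin {zero}  f = 0
sumFin {suc n} f = f zero +ℕ sumFin (λ i → f (suc i))

count : ∀ {n} → (Fin n → Bool) → ℕ
count f = sumFin (λ i → if f i then 1 else 0)

card : ∀ {n} → VSet n → ℕ
card X = count X

_⊆_ : ∀ {n} → VSet n → VSet n → Set
X ⊆ Y = ∀ i → X i ≡ true → Y i ≡ true

_∖_ : ∀ {n} → VSet n → VSet n → VSet n
(Y ∖ X) i = Y i ∧ not (X i)

-- e(X): edges spanned by X (unordered pairs {i,j}, counted once via i < j)
eIn : ∀ {n} → Graph n → VSet n → ℕ
eIn G X = sumFin (λ i → count (λ j → X i ∧ X j ∧ adj G i j ∧ ⌊ i <? j ⌋))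

eBetween : ∀ {n} → Graph n → VSet n → VSet n → ℕ
eBetween G X Y = sumFin (λ i → count (λ j → X i ∧ Y j ∧ adj G i j))

degIn : ∀ {n} → Graph n → VSet n → Fin n → ℕ
degIn G S v = count (λ u → S u ∧ adj G v u)

Jumbled : ∀ {n} → Graph n → ℚ → ℚ → Set
Jumbled G p β = ∀ X →
  ∣ ℕ→ℚ (eIn G X) - p * ℕ→ℚ (card X) * ℕ→ℚ (card X) * ½ ∣ ≤ β * ℕ→ℚ (card X)

GoodSubgraph : ∀ {n} → Graph n → ℚ → ℚ → VSet n → Set
GoodSubgraph {n} G p ε S =
  ((1ℚ - ε) * ℕ→ℚ n ≤ ℕ→ℚ (card S))
  × (∀ v → S v ≡ true →
       ((1ℚ - ε) * ℕ→ℚ (card S) * p ≤ ℕ→ℚ (degIn G S v))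
       × (ℕ→ℚ (degIn G S v) ≤ (1ℚ + ε) * ℕ→ℚ (card S) * p))
  × (∀ X → X ⊆ S →
       (1ℚ - ε) * p * ℕ→ℚ (card X) * ℕ→ℚ (card S ∸ℕ card X)
         ≤ ℕ→ℚ (eBetween G X (S ∖ X)))

module Submission where

-- Fix γ = ε/8, κ = ε/128 and assume β ≤ (ε²/4096)np.  Jumbledness
-- fixes e(X) up to β|X|; combined with e(X,V) + e(V∖X) = e(V) + e(X) it fixes
-- every degree sum e(X,V) up to 2βn, so at most κn vertices have degree outside
-- (1±γ)np.  Discard them and then greedily delete vertices of degree below
-- (1-2γ)np in the current set.  Each deleted vertex has ≥ γnp neighbours among
-- the discarded vertices; by jumbledness again at most κn are deleted.  In the
-- final set S every degree lies in [(1-2γ)np, (1+γ)np], and for |X| ≤ |S|/2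
-- the cut is e(X,S) - 2e(X) ≥ |X|(1-2γ)np - p|X|² - 2β|X|; larger X are
-- handled through S∖X.

open import Defs hiding (sym; irrefl)

module Counting where
  open import Data.Nat using (ℕ; zero; suc; _+_; _≤_; z≤n; s≤s)
  open import Data.Nat.Properties using (≤-refl; ≤-reflexive; ≤-trans; +-mono-≤; m≤m+n; m≤n+m; +-suc; suc-injective)
  open import Data.Nat.Solver using (module +-*-Solver)
  open import Data.Bool using (Bool; true; false; _∧_; _∨_; not; if_then_else_)
  open import Data.Fin using (Fin; zero; suc; _<?_) renaming (_<_ to _<ᶠ_)
  open import Data.Fin.Properties using (<-cmp)
  open import Relation.Binary using (tri<; tri≈; tri>)
  open import Relation.Binary.PropositionalEquality
  open import Relation.Nullary using (¬_)
  open import Relation.Nullary.Decidable using (⌊_⌋; isYes≗does; dec-true; dec-false)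
  open ≡-Reasoning

  ind : Bool → ℕ
  ind b = if b then 1 else 0

  sumFin-cong : ∀ {n} {f g : Fin n → ℕ} → (∀ i → f i ≡ g i) → sumFin f ≡ sumFin g
  sumFin-cong {zero}  h = refl
  sumFin-cong {suc n} h = cong₂ _+_ (h zero) (sumFin-cong (λ i → h (suc i)))

  sumFin-+ : ∀ {n} (f g : Fin n → ℕ) → sumFin (λ i → f i + g i) ≡ sumFin f + sumFin g
  sumFin-+ {zero}  f g = refl
  sumFin-+ {suc n} f g = begin
    (f zero + g zero) + sumFin (λ i → f (suc i) + g (suc i))
      ≡⟨ cong (f zero + g zero +_) (sumFin-+ (λ i → f (suc i)) (λ i → g (suc i))) ⟩
    (f zero + g zero) + (sumFin (λ i → f (suc i)) + sumFin (λ i → g (suc i)))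
      ≡⟨ interchange (f zero) (g zero) _ _ ⟩
    (f zero + sumFin (λ i → f (suc i))) + (g zero + sumFin (λ i → g (suc i))) ∎
    where
    open +-*-Solver
    interchange : ∀ a b c d → (a + b) + (c + d) ≡ (a + c) + (b + d)
    interchange = solve 4 (λ a b c d → (a :+ b) :+ (c :+ d) := (a :+ c) :+ (b :+ d)) refl

  sumFin-mono : ∀ {n} {f g : Fin n → ℕ} → (∀ i → f i ≤ g i) → sumFin f ≤ sumFin g
  sumFin-mono {zero}  h = z≤n
  sumFin-mono {suc n} h = +-mono-≤ (h zero) (sumFin-mono (λ i → h (suc i)))

  sumFin-zero : ∀ {n} {f : Fin n → ℕ} → (∀ i → f i ≡ 0) → sumFin f ≡ 0
  sumFin-zero {zero}  h = refl
  sumFin-zero {suc n} h rewrite h zero = sumFin-zero (λ i → h (suc i))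

  term≤sumFin : ∀ {n} (f : Fin n → ℕ) v → f v ≤ sumFin f
  term≤sumFin f zero    = m≤m+n _ _
  term≤sumFin f (suc v) = ≤-trans (term≤sumFin (λ i → f (suc i)) v) (m≤n+m _ _)

  sumFin-swap : ∀ {n m} (f : Fin n → Fin m → ℕ) →
    sumFin (λ i → sumFin (λ j → f i j)) ≡ sumFin (λ j → sumFin (λ i → f i j))
  sumFin-swap {zero} {m} f = sym (sumFin-zero {m} (λ j → refl))
  sumFin-swap {suc n} f = begin
    sumFin (f zero) + sumFin (λ i → sumFin (f (suc i)))
      ≡⟨ cong (sumFin (f zero) +_) (sumFin-swap (λ i → f (suc i))) ⟩
    sumFin (f zero) + sumFin (λ j → sumFin (λ i → f (suc i) j))
      ≡⟨ sym (sumFin-+ (f zero) (λ j → sumFin (λ i → f (suc i) j))) ⟩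
    sumFin (λ j → f zero j + sumFin (λ i → f (suc i) j)) ∎

  _=ᵛ_ : ∀ {n} → Fin n → Fin n → Bool
  zero  =ᵛ zero  = true
  zero  =ᵛ suc _ = false
  suc _ =ᵛ zero  = false
  suc a =ᵛ suc b = a =ᵛ b

  =ᵛ-sound : ∀ {n} (u v : Fin n) → u =ᵛ v ≡ true → u ≡ v
  =ᵛ-sound zero    zero    _ = refl
  =ᵛ-sound (suc u) (suc v) e = cong suc (=ᵛ-sound u v e)

  card-singleton : ∀ {n} (v : Fin n) → card (λ u → u =ᵛ v) ≡ 1
  card-singleton {suc n} zero    = cong suc (sumFin-zero {n} (λ _ → refl))
  card-singleton {suc n} (suc v) = card-singleton v

  all : ∀ {n} → VSet n
  all _ = true

  card-all : ∀ n → card (all {n}) ≡ n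
  card-all zero    = refl
  card-all (suc n) = cong suc (card-all n)

  Partition : ∀ {n} → VSet n → VSet n → VSet n → Set
  Partition Y Y₁ Y₂ = ∀ j → ind (Y j) ≡ ind (Y₁ j) + ind (Y₂ j)

  card-partition : ∀ {n} {Y Y₁ Y₂ : VSet n} → Partition Y Y₁ Y₂ → card Y ≡ card Y₁ + card Y₂
  card-partition {n} h = trans (sumFin-cong {n} h) (sumFin-+ {n} _ _)

  ⊆-partition : ∀ {n} {X S : VSet n} → X ⊆ S → Partition S X (S ∖ X)
  ⊆-partition {X = X} {S} h j with X j | h j
  ... | true  | hj rewrite hj refl = refl
  ... | false | _ with S j
  ...   | true  = refl
  ...   | false = refl

  all-partition : ∀ {n} (X : VSet n) → Partition all X (all ∖ X)
  all-partition X = ⊆-partition {X = X} {all} (λ _ _ → refl)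

  ∧-partition : ∀ x y y₁ y₂ a → ind y ≡ ind y₁ + ind y₂ →
    ind (x ∧ y ∧ a) ≡ ind (x ∧ y₁ ∧ a) + ind (x ∧ y₂ ∧ a)
  ∧-partition false y y₁ y₂ a h = refl
  ∧-partition true  y y₁ y₂ false h with y | y₁ | y₂
  ... | false | false | false = refl
  ... | false | false | true  = refl
  ... | false | true  | false = refl
  ... | false | true  | true  = refl
  ... | true  | false | false = refl
  ... | true  | false | true  = refl
  ... | true  | true  | false = refl
  ... | true  | true  | true  = refl
  ∧-partition true false false false true h  = refl
  ∧-partition true false false true  true ()
  ∧-partition true false true  _     true ()
  ∧-partition true true  false false true ()
  ∧-partition true true  false true  true h  = refl
  ∧-partition true true  true  false true h  = refl
  ∧-partition true true  true  true  true ()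

  ∧-mono : ∀ {x x'} → (x ≡ true → x' ≡ true) → ∀ a → ind (x ∧ a) ≤ ind (x' ∧ a)
  ∧-mono {false} h a = z≤n
  ∧-mono {true}  h a rewrite h refl = ≤-refl

  card-∨ : ∀ {n} (X Y : VSet n) → card (λ i → X i ∨ Y i) ≤ card X + card Y
  card-∨ {n} X Y = ≤-trans (sumFin-mono {n} (λ i → ind-∨ (X i) (Y i))) (≤-reflexive (sumFin-+ {n} _ _))
    where
    ind-∨ : ∀ a b → ind (a ∨ b) ≤ ind a + ind b
    ind-∨ false false = z≤n
    ind-∨ false true  = ≤-refl
    ind-∨ true  false = ≤-refl
    ind-∨ true  true  = s≤s z≤n

  card≤n : ∀ {n} (S : VSet n) → card S ≤ n
  card≤n {n} S = ≤-trans (sumFin-mono {n} (λ u → ind≤1 (S u))) (≤-reflexive (card-all n))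
    where
    ind≤1 : ∀ b → ind b ≤ 1
    ind≤1 false = z≤n
    ind≤1 true  = ≤-refl

  ∖-⊆ : ∀ {n} (S X : VSet n) → (S ∖ X) ⊆ S
  ∖-⊆ S X u h with S u
  ... | true = refl

  ∖-involutive : ∀ {n} {X S : VSet n} → X ⊆ S → ∀ u → (S ∖ (S ∖ X)) u ≡ X u
  ∖-involutive {X = X} {S} h u with X u | h u
  ... | true  | hu rewrite hu refl = refl
  ... | false | _ with S u
  ...   | true  = refl
  ...   | false = refl

  _─_ : ∀ {n} → VSet n → Fin n → VSet n
  (S ─ v) u = S u ∧ not (u =ᵛ v)

  card-─ : ∀ {n} (S : VSet n) v → S v ≡ true → card S ≡ card (S ─ v) + 1
  card-─ {n} S v Sv =
    trans (card-partition {n} {S} {S ─ v} {λ u → S u ∧ (u =ᵛ v)} (λ u → by-v (S u) (u =ᵛ v)))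
          (cong (card (S ─ v) +_) (trans (sumFin-cong {n} (λ u → only-v u (u =ᵛ v) refl)) (card-singleton v)))
    where
    by-v : ∀ s e → ind s ≡ ind (s ∧ not e) + ind (s ∧ e)
    by-v false e     = refl
    by-v true  false = refl
    by-v true  true  = refl
    only-v : ∀ u e → u =ᵛ v ≡ e → ind (S u ∧ e) ≡ ind e
    only-v u false _ with S u
    ... | true  = refl
    ... | false = refl
    only-v u true e rewrite =ᵛ-sound u v e | Sv = refl

  complement-─ : ∀ {n} (S : VSet n) v → (all ∖ S) ⊆ (all ∖ (S ─ v))
  complement-─ S v u h with S u
  ... | false = refl

  outside-─ : ∀ {n} (S T : VSet n) v u → ((all ∖ (S ─ v)) ∖ T) u ≡ true → u =ᵛ v ≡ false →
    ((all ∖ S) ∖ T) u ≡ true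
  outside-─ S T v u h e rewrite e with S u
  ... | true  = h
  ... | false = h

  card-outside-─ : ∀ {n} (S T : VSet n) v → card ((all ∖ (S ─ v)) ∖ T) ≤ card ((all ∖ S) ∖ T) + 1
  card-outside-─ {n} S T v =
    ≤-trans (sumFin-mono {n} (λ u → at (S u) (u =ᵛ v) (T u)))
            (≤-reflexive (trans (sumFin-+ {n} _ _) (cong (card ((all ∖ S) ∖ T) +_) (card-singleton v))))
    where
    at : ∀ s e t → ind (not (s ∧ not e) ∧ not t) ≤ ind (not s ∧ not t) + ind e
    at false e     false = s≤s z≤n
    at false e     true  = z≤n
    at true  false t     = z≤n
    at true  true  false = ≤-refl
    at true  true  true  = z≤n

  contrapositive : ∀ {s} b → (b ≡ true → s ≡ false) → s ≡ true → b ≡ false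
  contrapositive false _ _    = refl
  contrapositive true  f refl with f refl
  ... | ()

  double-injective : ∀ a b → a + a ≡ b + b → a ≡ b
  double-injective zero    zero    h = refl
  double-injective (suc a) (suc b) h rewrite +-suc a a | +-suc b b =
    cong suc (double-injective a b (suc-injective (suc-injective h)))

  module Edges {n : ℕ} (G : Graph n) where

    eBetween-degSum : ∀ X Y → eBetween G X Y ≡ sumFin (λ i → if X i then degIn G Y i else 0)
    eBetween-degSum X Y = sumFin-cong {n} rowsum
      where
      rowsum : ∀ i → count (λ j → X i ∧ Y j ∧ adj G i j) ≡ (if X i then degIn G Y i else 0)
      rowsum i with X i
      ... | true  = refl
      ... | false = sumFin-zero {n} (λ _ → refl)

    eBetween-comm : ∀ X Y → eBetween G X Y ≡ eBetween G Y X
    eBetween-comm X Y =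
      trans (sumFin-swap {n} {n} _) (sumFin-cong {n} (λ i → sumFin-cong {n} (λ j → entry i j)))
      where
      entry : ∀ i j → ind (X j ∧ Y i ∧ adj G j i) ≡ ind (Y i ∧ X j ∧ adj G i j)
      entry i j rewrite Graph.sym G j i with X j | Y i
      ... | true  | true  = refl
      ... | true  | false = refl
      ... | false | true  = refl
      ... | false | false = refl

    eBetween-partition : ∀ X {Y Y₁ Y₂} → Partition Y Y₁ Y₂ →
      eBetween G X Y ≡ eBetween G X Y₁ + eBetween G X Y₂
    eBetween-partition X {Y} {Y₁} {Y₂} h =
      trans (sumFin-cong {n} (λ i → trans (sumFin-cong {n} (λ j → entry i j)) (sumFin-+ {n} _ _)))
            (sumFin-+ {n} _ _)
      where
      entry : ∀ i j → ind (X i ∧ Y j ∧ adj G i j)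
                      ≡ ind (X i ∧ Y₁ j ∧ adj G i j) + ind (X i ∧ Y₂ j ∧ adj G i j)
      entry i j = ∧-partition (X i) (Y j) (Y₁ j) (Y₂ j) (adj G i j) (h j)

    eBetween-congʳ : ∀ X {Y Y'} → (∀ j → Y j ≡ Y' j) → eBetween G X Y ≡ eBetween G X Y'
    eBetween-congʳ X h = sumFin-cong {n} (λ i → sumFin-cong {n} (λ j → cong (λ y → ind (X i ∧ y ∧ adj G i j)) (h j)))

    eBetween-mono : ∀ {X X'} Y → X ⊆ X' → eBetween G X Y ≤ eBetween G X' Y
    eBetween-mono Y h = sumFin-mono {n} (λ i → sumFin-mono {n} (λ j → ∧-mono (h i) (Y j ∧ adj G i j)))

    degIn-partition : ∀ v {S S₁ S₂} → Partition S S₁ S₂ → degIn G S v ≡ degIn G S₁ v + degIn G S₂ v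
    degIn-partition v {S} {S₁} {S₂} h =
      trans (sumFin-cong {n} (λ u → ∧-partition true (S u) (S₁ u) (S₂ u) (adj G v u) (h u))) (sumFin-+ {n} _ _)

    degIn-mono : ∀ v {S S'} → S ⊆ S' → degIn G S v ≤ degIn G S' v
    degIn-mono v h = sumFin-mono {n} (λ u → ∧-mono (h u) (adj G v u))

    -- Every edge inside X is counted twice in e(X,X): once from each endpoint.
    eBetween-self : ∀ X → eBetween G X X ≡ eIn G X + eIn G X
    eBetween-self X =
      trans (sumFin-cong {n} (λ i → trans (sumFin-cong {n} (λ j → orient i j)) (sumFin-+ {n} _ _)))
        (trans (sumFin-+ {n} _ _)
               (cong (eIn G X +_) (sumFin-swap {n} {n} (λ i j → ind (X j ∧ X i ∧ adj G j i ∧ ⌊ j <? i ⌋)))))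
      where
      ordered : ∀ {i j} → i <ᶠ j → ⌊ i <? j ⌋ ≡ true
      ordered {i} {j} p = trans (isYes≗does (i <? j)) (dec-true (i <? j) p)
      unordered : ∀ {i j} → ¬ (i <ᶠ j) → ⌊ i <? j ⌋ ≡ false
      unordered {i} {j} p = trans (isYes≗does (i <? j)) (dec-false (i <? j) p)
      byOrder : ∀ x y a l → ind (x ∧ y ∧ a) ≡ ind (x ∧ y ∧ a ∧ l) + ind (y ∧ x ∧ a ∧ not l)
      byOrder false false a l = refl
      byOrder false true  a l = refl
      byOrder true  false a l = refl
      byOrder true  true  false l = refl
      byOrder true  true  true  false = refl
      byOrder true  true  true  true  = refl
      loop : ∀ x l → ind (x ∧ x ∧ false) ≡ ind (x ∧ x ∧ false ∧ l) + ind (x ∧ x ∧ false ∧ l)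
      loop false l = refl
      loop true  l = refl
      -- the pair (i,j) is counted in e(X) as (i,j) if i < j and as (j,i) if j < i
      orient : ∀ i j → ind (X i ∧ X j ∧ adj G i j)
                       ≡ ind (X i ∧ X j ∧ adj G i j ∧ ⌊ i <? j ⌋) + ind (X j ∧ X i ∧ adj G j i ∧ ⌊ j <? i ⌋)
      orient i j with <-cmp i j
      ... | tri< i<j _ j≮i rewrite ordered i<j | unordered j≮i | Graph.sym G j i = byOrder (X i) (X j) (adj G i j) true
      ... | tri> i≮j _ j<i rewrite ordered j<i | unordered i≮j | Graph.sym G j i = byOrder (X i) (X j) (adj G i j) false
      ... | tri≈ _ refl _  rewrite Graph.irrefl G i = loop (X i) ⌊ i <? i ⌋

    eBetween-sub : ∀ {X S} → X ⊆ S → eBetween G X S ≡ (eIn G X + eIn G X) + eBetween G X (S ∖ X)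
    eBetween-sub {X} {S} h =
      trans (eBetween-partition X (⊆-partition h)) (cong (_+ eBetween G X (S ∖ X)) (eBetween-self X))

    eBetween-complement : ∀ X → eBetween G X all + eIn G (all ∖ X) ≡ eIn G all + eIn G X
    eBetween-complement X = double-injective _ _ doubled
      where
      C = all ∖ X
      xx = eBetween G X X
      xc = eBetween G X C
      cc = eBetween G C C
      split-X : eBetween G X all ≡ xx + xc
      split-X = eBetween-partition X (all-partition X)
      split-C : eBetween G C all ≡ xc + cc
      split-C = trans (eBetween-partition C (all-partition X)) (cong (_+ cc) (eBetween-comm C X))
      total : eIn G all + eIn G all ≡ (xx + xc) + (xc + cc)
      total = begin
        eIn G all + eIn G all           ≡⟨ sym (eBetween-self all) ⟩
        eBetween G all all              ≡⟨ eBetween-partition all (all-partition X) ⟩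
        eBetween G all X + eBetween G all C ≡⟨ cong₂ _+_ (eBetween-comm all X) (eBetween-comm all C) ⟩
        eBetween G X all + eBetween G C all ≡⟨ cong₂ _+_ split-X split-C ⟩
        (xx + xc) + (xc + cc)           ∎
      open +-*-Solver
      doubled : (eBetween G X all + eIn G C) + (eBetween G X all + eIn G C)
                ≡ (eIn G all + eIn G X) + (eIn G all + eIn G X)
      doubled = begin
        (eBetween G X all + eIn G C) + (eBetween G X all + eIn G C)
          ≡⟨ cong (λ z → (z + eIn G C) + (z + eIn G C)) split-X ⟩
        (xx + xc + eIn G C) + (xx + xc + eIn G C)
          ≡⟨ solve 3 (λ a b c → (a :+ b :+ c) :+ (a :+ b :+ c) := (a :+ b) :+ (b :+ (c :+ c)) :+ a)
                     refl xx xc (eIn G C) ⟩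
        (xx + xc) + (xc + (eIn G C + eIn G C)) + xx
          ≡⟨ cong₂ (λ z w → (xx + xc) + (xc + z) + w) (sym (eBetween-self C)) (eBetween-self X) ⟩
        (xx + xc) + (xc + cc) + (eIn G X + eIn G X)
          ≡⟨ cong (_+ (eIn G X + eIn G X)) (sym total) ⟩
        (eIn G all + eIn G all) + (eIn G X + eIn G X)
          ≡⟨ solve 2 (λ a b → (a :+ a) :+ (b :+ b) := (a :+ b) :+ (a :+ b)) refl (eIn G all) (eIn G X) ⟩
        (eIn G all + eIn G X) + (eIn G all + eIn G X) ∎

module Cast where
  open import Data.Nat as ℕ using (ℕ)
  import Data.Nat.Properties as ℕP
  import Data.Nat.Coprimality as Coprimality
  open import Data.Integer as ℤ using (+_; +[1+_]; -[1+_])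
  import Data.Integer.Properties as ℤP
  import Data.Integer.Solver as ℤSolver
  open import Data.Rational
  open import Data.Rational.Properties
  open import Data.Rational.Solver using (module +-*-Solver)
  import Data.Rational.Unnormalised as ℚᵘ
  import Data.Rational.Unnormalised.Properties as ℚᵘP
  open import Data.Sum using (inj₁; inj₂)
  open import Relation.Binary.PropositionalEquality

  coprime-1 : ∀ a → Coprimality.Coprime a 1
  coprime-1 a = Coprimality.sym (Coprimality.1-coprimeTo a)

  ℕ→ℚ-mkℚ : ∀ a → ℕ→ℚ a ≡ mkℚ (+ a) 0 (coprime-1 a)
  ℕ→ℚ-mkℚ a = ↥p/↧p≡p (mkℚ (+ a) 0 _)

  -- ℕ→ℚ is additive (checked on unnormalised representatives) and monotone,
  -- hence also respects truncated subtraction.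
  ℕ→ℚ-+ : ∀ a b → ℕ→ℚ (a ℕ.+ b) ≡ ℕ→ℚ a + ℕ→ℚ b
  ℕ→ℚ-+ a b rewrite ℕ→ℚ-mkℚ a | ℕ→ℚ-mkℚ b | ℕ→ℚ-mkℚ (a ℕ.+ b) =
    toℚᵘ-injective (ℚᵘP.≃-trans (ℚᵘ.*≡* cross) (ℚᵘP.≃-sym (toℚᵘ-homo-+ (mkℚ (+ a) 0 (coprime-1 a)) (mkℚ (+ b) 0 (coprime-1 b)))))
    where
    open ℤSolver.+-*-Solver
    cross : + (a ℕ.+ b) ℤ.* (+ 1 ℤ.* + 1) ≡ (+ a ℤ.* + 1 ℤ.+ + b ℤ.* + 1) ℤ.* + 1
    cross rewrite ℤP.pos-+ a b =
      solve 2 (λ x y → (x :+ y) :* (con (+ 1) :* con (+ 1)) := (x :* con (+ 1) :+ y :* con (+ 1)) :* con (+ 1))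
            refl (+ a) (+ b)

  ℕ→ℚ-mono : ∀ {a b} → a ℕ.≤ b → ℕ→ℚ a ≤ ℕ→ℚ b
  ℕ→ℚ-mono {a} {b} h rewrite ℕ→ℚ-mkℚ a | ℕ→ℚ-mkℚ b = *≤* (ℤP.*-monoʳ-≤-nonNeg (+ 1) (ℤ.+≤+ h))

  ℕ→ℚ-∸ : ∀ a b → b ℕ.≤ a → ℕ→ℚ (a ℕ.∸ b) ≡ ℕ→ℚ a - ℕ→ℚ b
  ℕ→ℚ-∸ a b h = begin
    ℕ→ℚ (a ℕ.∸ b)                   ≡⟨ solve 2 (λ x y → x := (x :+ y) :- y) refl (ℕ→ℚ (a ℕ.∸ b)) (ℕ→ℚ b) ⟩
    (ℕ→ℚ (a ℕ.∸ b) + ℕ→ℚ b) - ℕ→ℚ b ≡⟨ cong (_- ℕ→ℚ b) (sym (ℕ→ℚ-+ (a ℕ.∸ b) b)) ⟩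
    ℕ→ℚ (a ℕ.∸ b ℕ.+ b) - ℕ→ℚ b     ≡⟨ cong (λ z → ℕ→ℚ z - ℕ→ℚ b) (ℕP.m∸n+n≡m h) ⟩
    ℕ→ℚ a - ℕ→ℚ b                   ∎
    where
    open ≡-Reasoning
    open +-*-Solver

  archimedean : ∀ q → 0ℚ < q → ∀ n → ↧ₙ q ℕ.≤ n → 1ℚ ≤ q * ℕ→ℚ n
  archimedean (mkℚ +[1+ a ] d c) _ n d<n rewrite ℕ→ℚ-mkℚ n =
    toℚᵘ-cancel-≤ (ℚᵘP.≤-respʳ-≃ (ℚᵘP.≃-sym (toℚᵘ-homo-* (mkℚ +[1+ a ] d c) (mkℚ (+ n) 0 (coprime-1 n))))
      (ℚᵘ.*≤* (ℤP.≤-trans (ℤP.≤-reflexive (ℤP.*-identityˡ _))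
                 (ℤP.≤-trans cross (ℤP.≤-reflexive (sym (ℤP.*-identityʳ _)))))))
    where
    crossℕ : ℕ.suc (d ℕ.* 1) ℕ.≤ ℕ.suc a ℕ.* n
    crossℕ = ℕP.≤-trans (ℕP.≤-reflexive (cong ℕ.suc (ℕP.*-identityʳ d))) (ℕP.≤-trans d<n (ℕP.m≤n*m n (ℕ.suc a)))
    cross : + ℕ.suc (d ℕ.* 1) ℤ.≤ + ℕ.suc a ℤ.* + n
    cross = subst (+ ℕ.suc (d ℕ.* 1) ℤ.≤_) (ℤP.pos-* (ℕ.suc a) n) (ℤ.+≤+ crossℕ)
  archimedean (mkℚ (+ 0) d c) (*<* (ℤ.+<+ ())) n _
  archimedean (mkℚ -[1+ a ] d c) (*<* ()) n _

  -- An opaque copy of ℕ→ℚ, used throughout the construction: it keeps the type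
  -- checker from unfolding the normalisation of n/1 inside large rational terms.
  opaque
    ⟦_⟧ : ℕ → ℚ
    ⟦_⟧ = ℕ→ℚ

    ⟦⟧≡ℕ→ℚ : ⟦_⟧ ≡ ℕ→ℚ
    ⟦⟧≡ℕ→ℚ = refl

    ⟦⟧-+ : ∀ a b → ⟦ a ℕ.+ b ⟧ ≡ ⟦ a ⟧ + ⟦ b ⟧
    ⟦⟧-+ = ℕ→ℚ-+

    ⟦⟧-mono : ∀ {a b} → a ℕ.≤ b → ⟦ a ⟧ ≤ ⟦ b ⟧
    ⟦⟧-mono = ℕ→ℚ-mono

    ⟦⟧-∸ : ∀ a b → b ℕ.≤ a → ⟦ a ℕ.∸ b ⟧ ≡ ⟦ a ⟧ - ⟦ b ⟧
    ⟦⟧-∸ = ℕ→ℚ-∸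

    ⟦0⟧ : ⟦ 0 ⟧ ≡ 0ℚ
    ⟦0⟧ = refl

    ⟦1⟧ : ⟦ 1 ⟧ ≡ 1ℚ
    ⟦1⟧ = refl

  0≤⟦⟧ : ∀ a → 0ℚ ≤ ⟦ a ⟧
  0≤⟦⟧ a = subst (_≤ ⟦ a ⟧) ⟦0⟧ (⟦⟧-mono ℕ.z≤n)

  -- Sign-condition versions of the library's instance-based monotonicity lemmas.
  0≤* : ∀ {a b} → 0ℚ ≤ a → 0ℚ ≤ b → 0ℚ ≤ a * b
  0≤* {a} {b} ha hb = nonNegative⁻¹ (a * b) {{nonNeg*nonNeg⇒nonNeg a {{nonNegative ha}} b {{nonNegative hb}}}}

  0<* : ∀ {a b} → 0ℚ < a → 0ℚ < b → 0ℚ < a * b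
  0<* {a} {b} ha hb = positive⁻¹ (a * b) {{pos*pos⇒pos a {{positive ha}} b {{positive hb}}}}

  *-monoˡ : ∀ {c a b} → 0ℚ ≤ c → a ≤ b → c * a ≤ c * b
  *-monoˡ {c} hc h = *-monoˡ-≤-nonNeg c {{nonNegative hc}} h

  *-monoʳ : ∀ {c a b} → 0ℚ ≤ c → a ≤ b → a * c ≤ b * c
  *-monoʳ {c} hc h = *-monoʳ-≤-nonNeg c {{nonNegative hc}} h

  *-cancelˡ : ∀ {c a b} → 0ℚ < c → c * a ≤ c * b → a ≤ b
  *-cancelˡ {c} hc h = *-cancelˡ-≤-pos c {{positive hc}} h

  -‿mono : ∀ {a a' b b'} → a ≤ a' → b' ≤ b → a - b ≤ a' - b'
  -‿mono h h' = +-mono-≤ h (neg-antimono-≤ h')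

  0≤-⇒≤ : ∀ {a b} → 0ℚ ≤ b - a → a ≤ b
  0≤-⇒≤ {a} {b} h = begin
    a            ≡⟨ sym (+-identityʳ a) ⟩
    a + 0ℚ       ≤⟨ +-monoʳ-≤ a h ⟩
    a + (b - a)  ≡⟨ solve 2 (λ a b → a :+ (b :- a) := b) refl a b ⟩
    b            ∎
    where
    open ≤-Reasoning
    open +-*-Solver

  ≤⇒0≤- : ∀ {a b} → a ≤ b → 0ℚ ≤ b - a
  ≤⇒0≤- {a} {b} h = begin
    0ℚ     ≡⟨ sym (+-inverseʳ a) ⟩
    a - a  ≤⟨ +-monoˡ-≤ (- a) h ⟩
    b - a  ∎
    where open ≤-Reasoning

  ∣∣≤⇒≤ : ∀ {x y} → ∣ x ∣ ≤ y → x ≤ y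
  ∣∣≤⇒≤ {x} {y} h with ∣p∣≡p∨∣p∣≡-p x
  ... | inj₁ e = subst (_≤ y) e h
  ... | inj₂ e = ≤-trans x≤0 (≤-trans (0≤∣p∣ x) h)
    where
    open +-*-Solver
    x≤0 : x ≤ 0ℚ
    x≤0 = subst (_≤ 0ℚ) (solve 1 (λ x → :- (:- x) := x) refl x)
                (neg-antimono-≤ (subst (0ℚ ≤_) e (0≤∣p∣ x)))

  ∣∣≤⇒≥- : ∀ {x y} → ∣ x ∣ ≤ y → - y ≤ x
  ∣∣≤⇒≥- {x} {y} h =
    subst (- y ≤_) (solve 1 (λ x → :- (:- x) := x) refl x)
          (neg-antimono-≤ (∣∣≤⇒≤ (subst (_≤ y) (sym (∣-p∣≡∣p∣ x)) h)))
    where open +-*-Solver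

module Calculations where
  open import Data.Integer using (+_)
  open import Data.Rational
  open import Data.Rational.Properties
  open import Data.Rational.Solver using (module +-*-Solver)
  open import Relation.Binary.PropositionalEquality
  open import Relation.Nullary.Decidable using (True; toWitness)
  open Cast
  open +-*-Solver using (solve; con; _:+_; _:*_; _:-_; :-_; _:=_)
  open ≤-Reasoning

  decide≤ : (a b : ℚ) → {w : True (a ≤? b)} → a ≤ b
  decide≤ a b {w} = toWitness w

  decide< : (a b : ℚ) → {w : True (a <? b)} → a < b
  decide< a b {w} = toWitness w

  -- The constants of the proof, for the target accuracy ε ∈ (0,1]:
  --   γ = ε/8       vertices of degree outside (1±γ)np are discarded at once,
  --   δ = ε²/4096   the required bound β ≤ δ np,
  --   κ = ε/128     at most κn vertices are discarded in each of two stages.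
  γ δ κ : ℚ → ℚ
  γ ε = ε * (+ 1 / 8)
  δ ε = ε * ε * (+ 1 / 4096)
  κ ε = ε * (+ 1 / 128)

  δ≤ : ∀ ε → 0ℚ ≤ ε → ε ≤ 1ℚ → δ ε ≤ ε * (+ 1 / 4096)
  δ≤ ε 0≤ε ε≤1 = begin
    ε * ε * (+ 1 / 4096)   ≤⟨ *-monoʳ (decide≤ 0ℚ (+ 1 / 4096)) (*-monoˡ 0≤ε ε≤1) ⟩
    ε * 1ℚ * (+ 1 / 4096)  ≡⟨ cong (_* (+ 1 / 4096)) (*-identityʳ ε) ⟩
    ε * (+ 1 / 4096)       ∎

  -- With d = e(X,V), x = |X|, c = |V∖X|, the
  -- identity d + e(V∖X) = e(V) + e(X) and the jumbledness bounds on e(V), e(X)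
  -- and e(V∖X) place d within 2β(x+c) of p·x·(x+c).
  degreeSum-upper : ∀ p β x c d eV eX eC → d + eC ≡ eV + eX →
    eV ≤ p * (x + c) * (x + c) * ½ + β * (x + c) →
    eX ≤ p * x * x * ½ + β * x →
    p * c * c * ½ - β * c ≤ eC →
    d ≤ p * x * (x + c) + (β * (x + c) + β * (x + c))
  degreeSum-upper p β x c d eV eX eC e hV hX hC = begin
    d                  ≡⟨ solve 2 (λ d eC → d := d :+ eC :- eC) refl d eC ⟩
    d + eC - eC        ≡⟨ cong (_- eC) e ⟩
    eV + eX - eC       ≤⟨ -‿mono (+-mono-≤ hV hX) hC ⟩
    (p * (x + c) * (x + c) * ½ + β * (x + c)) + (p * x * x * ½ + β * x) - (p * c * c * ½ - β * c)
      ≡⟨ solve 4 (λ p β x c → (p :* (x :+ c) :* (x :+ c) :* con ½ :+ β :* (x :+ c)) :+ (p :* x :* x :* con ½ :+ β :* x)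
                                :- (p :* c :* c :* con ½ :- β :* c)
                              := p :* x :* (x :+ c) :+ (β :* (x :+ c) :+ β :* (x :+ c))) refl p β x c ⟩
    p * x * (x + c) + (β * (x + c) + β * (x + c)) ∎

  degreeSum-lower : ∀ p β x c d eV eX eC → d + eC ≡ eV + eX →
    p * (x + c) * (x + c) * ½ - β * (x + c) ≤ eV →
    p * x * x * ½ - β * x ≤ eX →
    eC ≤ p * c * c * ½ + β * c →
    p * x * (x + c) - (β * (x + c) + β * (x + c)) ≤ d
  degreeSum-lower p β x c d eV eX eC e hV hX hC = begin
    p * x * (x + c) - (β * (x + c) + β * (x + c))
      ≡⟨ solve 4 (λ p β x c → p :* x :* (x :+ c) :- (β :* (x :+ c) :+ β :* (x :+ c))
                              := (p :* (x :+ c) :* (x :+ c) :* con ½ :- β :* (x :+ c)) :+ (p :* x :* x :* con ½ :- β :* x)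
                                 :- (p :* c :* c :* con ½ :+ β :* c)) refl p β x c ⟩
    (p * (x + c) * (x + c) * ½ - β * (x + c)) + (p * x * x * ½ - β * x) - (p * c * c * ½ + β * c)
      ≤⟨ -‿mono (+-mono-≤ hV hX) hC ⟩
    eV + eX - eC       ≡⟨ cong (_- eC) (sym e) ⟩
    d + eC - eC        ≡⟨ solve 2 (λ d eC → d :+ eC :- eC := d) refl d eC ⟩
    d                  ∎

  -- If every vertex of a set of size x has degree ≥ (1+γ)np, resp. ≤ (1-γ)np,
  -- while the degree sum is within 2βn of p·x·n, then γ·np·x ≤ 2βn.
  excess-high : ∀ p β ε n x d →
    x * ((1ℚ + γ ε) * n * p) ≤ d → d ≤ p * x * n + (β * n + β * n) →
    γ ε * (n * p) * x ≤ β * n + β * n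
  excess-high p β ε n x d h1 h2 = 0≤-⇒≤ (begin
    0ℚ ≤⟨ ≤⇒0≤- (≤-trans h1 h2) ⟩
    p * x * n + (β * n + β * n) - x * ((1ℚ + γ ε) * n * p)
      ≡⟨ solve 5 (λ p β ε n x → p :* x :* n :+ (β :* n :+ β :* n) :- x :* ((con 1ℚ :+ ε :* con (+ 1 / 8)) :* n :* p)
                               := (β :* n :+ β :* n) :- (ε :* con (+ 1 / 8)) :* (n :* p) :* x) refl p β ε n x ⟩
    (β * n + β * n) - γ ε * (n * p) * x ∎)

  excess-low : ∀ p β ε n x d →
    p * x * n - (β * n + β * n) ≤ d → d ≤ x * ((1ℚ - γ ε) * n * p) →
    γ ε * (n * p) * x ≤ β * n + β * n
  excess-low p β ε n x d h1 h2 = 0≤-⇒≤ (begin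
    0ℚ ≤⟨ ≤⇒0≤- (≤-trans h1 h2) ⟩
    x * ((1ℚ - γ ε) * n * p) - (p * x * n - (β * n + β * n))
      ≡⟨ solve 5 (λ p β ε n x → x :* ((con 1ℚ :- ε :* con (+ 1 / 8)) :* n :* p) :- (p :* x :* n :- (β :* n :+ β :* n))
                               := (β :* n :+ β :* n) :- (ε :* con (+ 1 / 8)) :* (n :* p) :* x) refl p β ε n x ⟩
    (β * n + β * n) - γ ε * (n * p) * x ∎)

  -- ... and then, since β ≤ δnp, such a set has at most κn/2 vertices.
  few-abnormal : ∀ p β ε n x → 0ℚ < p → 0ℚ < ε → 0ℚ < n →
    β ≤ δ ε * (n * p) → γ ε * (n * p) * x ≤ β * n + β * n → x ≤ κ ε * n * ½
  few-abnormal p β ε n x 0<p 0<ε 0<n hβ h =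
    *-cancelˡ (0<* 0<ε (decide< 0ℚ (+ 1 / 8))) (*-cancelˡ (0<* 0<n 0<p) (begin
      (n * p) * (γ ε * x)          ≡⟨ solve 4 (λ n p g x → (n :* p) :* (g :* x) := g :* (n :* p) :* x) refl n p (γ ε) x ⟩
      γ ε * (n * p) * x            ≤⟨ h ⟩
      β * n + β * n                ≤⟨ +-mono-≤ (*-monoʳ (<⇒≤ 0<n) hβ) (*-monoʳ (<⇒≤ 0<n) hβ) ⟩
      δ ε * (n * p) * n + δ ε * (n * p) * n
        ≡⟨ solve 3 (λ n p ε → (ε :* ε :* con (+ 1 / 4096)) :* (n :* p) :* n :+ (ε :* ε :* con (+ 1 / 4096)) :* (n :* p) :* n
                             := (n :* p) :* ((ε :* con (+ 1 / 8)) :* ((ε :* con (+ 1 / 128)) :* n :* con ½))) refl n p ε ⟩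
      (n * p) * (γ ε * (κ ε * n * ½)) ∎))

  size-slack : ∀ ε n b r → 0ℚ < ε → ε ≤ 1ℚ → 0ℚ < n → 1ℚ ≤ ε * n * (+ 1 / 32) →
    b ≤ κ ε * n → r ≤ κ ε * n + 1ℚ → (b + r) + (δ ε * n + δ ε * n) ≤ γ ε * n * ½
  size-slack ε n b r 0<ε ε≤1 0<n n-large hb hr = begin
    (b + r) + (δ ε * n + δ ε * n)
      ≤⟨ +-mono-≤ (+-mono-≤ hb hr) (+-mono-≤ δn≤ δn≤) ⟩
    κ ε * n + (κ ε * n + 1ℚ) + (ε * (+ 1 / 4096) * n + ε * (+ 1 / 4096) * n)
      ≤⟨ +-monoˡ-≤ _ (+-monoʳ-≤ (κ ε * n) (+-monoʳ-≤ (κ ε * n) n-large)) ⟩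
    κ ε * n + (κ ε * n + ε * n * (+ 1 / 32)) + (ε * (+ 1 / 4096) * n + ε * (+ 1 / 4096) * n)
      ≤⟨ 0≤-⇒≤ (subst (0ℚ ≤_) gap (0≤* (0≤* (<⇒≤ 0<ε) (<⇒≤ 0<n)) (decide≤ 0ℚ (+ 31 / 2048)))) ⟩
    γ ε * n * ½ ∎
    where
    δn≤ : δ ε * n ≤ ε * (+ 1 / 4096) * n
    δn≤ = *-monoʳ (<⇒≤ 0<n) (δ≤ ε (<⇒≤ 0<ε) ε≤1)
    gap : ε * n * (+ 31 / 2048) ≡ γ ε * n * ½ - (κ ε * n + (κ ε * n + ε * n * (+ 1 / 32))
                                                 + (ε * (+ 1 / 4096) * n + ε * (+ 1 / 4096) * n))
    gap = solve 2 (λ ε n → ε :* n :* con (+ 31 / 2048)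
                           := (ε :* con (+ 1 / 8)) :* n :* con ½
                              :- ((ε :* con (+ 1 / 128)) :* n :+ ((ε :* con (+ 1 / 128)) :* n :+ ε :* n :* con (+ 1 / 32))
                                  :+ (ε :* con (+ 1 / 4096) :* n :+ ε :* con (+ 1 / 4096) :* n))) refl ε n

  -- The bootstrap for the greedy deletion.  Let r vertices each send ≥ γnp
  -- edges into a set T of size t = b + r with b ≤ κn, so that r·γnp ≤ 2e(T)
  -- ≤ p t² + 2βt.  If r ≤ κn + 1, this forces r ≤ t/2, i.e. r ≤ b ≤ κn.
  removed-bound : ∀ p β ε n r b → 0ℚ < p → 0ℚ < ε → ε ≤ 1ℚ → 0ℚ < n → 1ℚ ≤ ε * n * (+ 1 / 32) →
    β ≤ δ ε * (n * p) → 0ℚ ≤ r → 0ℚ ≤ b → b ≤ κ ε * n → r ≤ κ ε * n + 1ℚ →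
    r * (γ ε * n * p) ≤ (p * (b + r) * (b + r) * ½ + β * (b + r)) + (p * (b + r) * (b + r) * ½ + β * (b + r)) →
    r ≤ κ ε * n
  removed-bound p β ε n r b 0<p 0<ε ε≤1 0<n n-large hβ 0≤r 0≤b hb hr h = ≤-trans r≤b hb
    where
    t = b + r
    0≤t : 0ℚ ≤ t
    0≤t = +-mono-≤ 0≤b 0≤r
    scaled : (γ ε * n * p) * r ≤ (γ ε * n * p) * (t * ½)
    scaled = begin
      (γ ε * n * p) * r  ≡⟨ *-comm _ r ⟩
      r * (γ ε * n * p)  ≤⟨ h ⟩
      (p * t * t * ½ + β * t) + (p * t * t * ½ + β * t)
        ≡⟨ solve 3 (λ p t β → (p :* t :* t :* con ½ :+ β :* t) :+ (p :* t :* t :* con ½ :+ β :* t)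
                              := p :* t :* t :+ (β :+ β) :* t) refl p t β ⟩
      p * t * t + (β + β) * t
        ≤⟨ +-monoʳ-≤ (p * t * t) (*-monoʳ 0≤t (+-mono-≤ hβ hβ)) ⟩
      p * t * t + (δ ε * (n * p) + δ ε * (n * p)) * t
        ≡⟨ solve 4 (λ p t d n → p :* t :* t :+ (d :* (n :* p) :+ d :* (n :* p)) :* t
                                := (p :* t) :* (t :+ (d :* n :+ d :* n))) refl p t (δ ε) n ⟩
      (p * t) * (t + (δ ε * n + δ ε * n))
        ≤⟨ *-monoˡ (0≤* (<⇒≤ 0<p) 0≤t) (size-slack ε n b r 0<ε ε≤1 0<n n-large hb hr) ⟩
      (p * t) * (γ ε * n * ½)
        ≡⟨ solve 4 (λ p t g n → (p :* t) :* (g :* n :* con ½) := (g :* n :* p) :* (t :* con ½)) refl p t (γ ε) n ⟩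
      (γ ε * n * p) * (t * ½) ∎
    r≤t/2 : r ≤ t * ½
    r≤t/2 = *-cancelˡ (0<* (0<* (0<* 0<ε (decide< 0ℚ (+ 1 / 8))) 0<n) 0<p) scaled
    r≤b : r ≤ b
    r≤b = 0≤-⇒≤ (subst (0ℚ ≤_) (solve 2 (λ b r → ((b :+ r) :* con ½ :- r) :+ ((b :+ r) :* con ½ :- r) := b :- r) refl b r)
                               (+-mono-≤ (≤⇒0≤- r≤t/2) (≤⇒0≤- r≤t/2)))

  order-bound : ∀ ε n n' b r → 0ℚ ≤ ε → 0ℚ ≤ n → n' + (b + r) ≡ n → b ≤ κ ε * n → r ≤ κ ε * n →
    (1ℚ - ε) * n ≤ n'
  order-bound ε n n' b r 0≤ε 0≤n e hb hr = begin
    (1ℚ - ε) * n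
      ≤⟨ 0≤-⇒≤ (subst (0ℚ ≤_) gap (0≤* (0≤* 0≤ε 0≤n) (decide≤ 0ℚ (+ 63 / 64)))) ⟩
    n - (κ ε * n + κ ε * n)  ≤⟨ -‿mono (≤-refl {n}) (+-mono-≤ hb hr) ⟩
    n - (b + r)              ≡⟨ cong (_- (b + r)) (sym e) ⟩
    n' + (b + r) - (b + r)   ≡⟨ solve 2 (λ a c → a :+ c :- c := a) refl n' (b + r) ⟩
    n'                       ∎
    where
    gap : ε * n * (+ 63 / 64) ≡ n - (κ ε * n + κ ε * n) - (1ℚ - ε) * n
    gap = solve 2 (λ ε n → ε :* n :* con (+ 63 / 64)
                           := n :- ((ε :* con (+ 1 / 128)) :* n :+ (ε :* con (+ 1 / 128)) :* n) :- (con 1ℚ :- ε) :* n) refl ε n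

  minDegree-bound : ∀ ε n n' p d → 0ℚ ≤ ε → ε ≤ 1ℚ → 0ℚ ≤ p → 0ℚ ≤ n → n' ≤ n →
    (1ℚ - (γ ε + γ ε)) * n * p ≤ d → (1ℚ - ε) * n' * p ≤ d
  minDegree-bound ε n n' p d 0≤ε ε≤1 0≤p 0≤n n'≤n h = ≤-trans (begin
    (1ℚ - ε) * n' * p    ≡⟨ solve 3 (λ e n p → (con 1ℚ :- e) :* n :* p := ((con 1ℚ :- e) :* p) :* n) refl ε n' p ⟩
    ((1ℚ - ε) * p) * n'  ≤⟨ *-monoˡ (0≤* (≤⇒0≤- ε≤1) 0≤p) n'≤n ⟩
    ((1ℚ - ε) * p) * n   ≤⟨ 0≤-⇒≤ (subst (0ℚ ≤_) gap (0≤* (0≤* (0≤* 0≤ε 0≤n) 0≤p) (decide≤ 0ℚ (+ 3 / 4)))) ⟩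
    (1ℚ - (γ ε + γ ε)) * n * p ∎) h
    where
    gap : ε * n * p * (+ 3 / 4) ≡ (1ℚ - (γ ε + γ ε)) * n * p - ((1ℚ - ε) * p) * n
    gap = solve 3 (λ ε n p → ε :* n :* p :* con (+ 3 / 4)
                             := (con 1ℚ :- (ε :* con (+ 1 / 8) :+ ε :* con (+ 1 / 8))) :* n :* p
                                :- ((con 1ℚ :- ε) :* p) :* n) refl ε n p

  maxDegree-bound : ∀ ε n n' p b r d → 0ℚ ≤ ε → ε ≤ 1ℚ → 0ℚ ≤ p → 0ℚ ≤ n →
    n' + (b + r) ≡ n → b ≤ κ ε * n → r ≤ κ ε * n →
    d ≤ (1ℚ + γ ε) * n * p → d ≤ (1ℚ + ε) * n' * p
  maxDegree-bound ε n n' p b r d 0≤ε ε≤1 0≤p 0≤n e hb hr h = ≤-trans h (begin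
    (1ℚ + γ ε) * n * p
      ≤⟨ 0≤-⇒≤ (subst (0ℚ ≤_) gap (+-mono-≤ (0≤* εnp (decide≤ 0ℚ (+ 54 / 64)))
                                            (0≤* (0≤* εnp (≤⇒0≤- ε≤1)) (decide≤ 0ℚ (+ 1 / 64))))) ⟩
    ((1ℚ + ε) * p) * (n - (κ ε * n + κ ε * n))
      ≤⟨ *-monoˡ (0≤* (+-mono-≤ (decide≤ 0ℚ 1ℚ) 0≤ε) 0≤p) (-‿mono (≤-refl {n}) (+-mono-≤ hb hr)) ⟩
    ((1ℚ + ε) * p) * (n - (b + r))
      ≡⟨ cong (λ z → ((1ℚ + ε) * p) * (z - (b + r))) (sym e) ⟩
    ((1ℚ + ε) * p) * (n' + (b + r) - (b + r))
      ≡⟨ solve 4 (λ e p a c → ((con 1ℚ :+ e) :* p) :* (a :+ c :- c) := (con 1ℚ :+ e) :* a :* p) refl ε p n' (b + r) ⟩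
    (1ℚ + ε) * n' * p ∎)
    where
    εnp : 0ℚ ≤ ε * n * p
    εnp = 0≤* (0≤* 0≤ε 0≤n) 0≤p
    gap : ε * n * p * (+ 54 / 64) + ε * n * p * (1ℚ - ε) * (+ 1 / 64)
          ≡ ((1ℚ + ε) * p) * (n - (κ ε * n + κ ε * n)) - (1ℚ + γ ε) * n * p
    gap = solve 3 (λ ε n p → ε :* n :* p :* con (+ 54 / 64) :+ ε :* n :* p :* (con 1ℚ :- ε) :* con (+ 1 / 64)
                             := ((con 1ℚ :+ ε) :* p) :* (n :- ((ε :* con (+ 1 / 128)) :* n :+ (ε :* con (+ 1 / 128)) :* n))
                                :- (con 1ℚ :+ ε :* con (+ 1 / 8)) :* n :* p) refl ε n p

  -- The cut estimate for a set X of size x ≤ n'/2 inside the final set of order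
  -- n': its degree sum ds ≥ x(1-2γ)np splits as 2e(X) + cut, and jumbledness
  -- bounds e(X) ≤ px²/2 + βx, leaving cut ≥ (1-ε)·p·x·(n'-x).
  smallCut-bound : ∀ ε n n' p β x ds eX cut → 0ℚ ≤ ε → ε ≤ 1ℚ → 0ℚ ≤ p → 0ℚ ≤ n → 0ℚ ≤ x →
    x + x ≤ n' → n' ≤ n → β ≤ δ ε * (n * p) →
    x * ((1ℚ - (γ ε + γ ε)) * n * p) ≤ ds → ds ≡ (eX + eX) + cut → eX ≤ p * x * x * ½ + β * x →
    (1ℚ - ε) * p * x * (n' - x) ≤ cut
  smallCut-bound ε n n' p β x ds eX cut 0≤ε ε≤1 0≤p 0≤n 0≤x 2x≤n' n'≤n hβ hds split heX = begin
    (1ℚ - ε) * p * x * (n' - x)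
      ≤⟨ *-monoˡ (0≤* (0≤* (≤⇒0≤- ε≤1) 0≤p) 0≤x) (-‿mono n'≤n (≤-refl {x})) ⟩
    (1ℚ - ε) * p * x * (n - x)
      ≤⟨ 0≤-⇒≤ (subst (0ℚ ≤_) gap (0≤* (0≤* 0≤p 0≤x) margin)) ⟩
    x * ((1ℚ - (γ ε + γ ε)) * n * p) - ((p * x * x * ½ + δ ε * (n * p) * x) + (p * x * x * ½ + δ ε * (n * p) * x))
      ≤⟨ -‿mono hds (+-mono-≤ eX≤ eX≤) ⟩
    ds - (eX + eX)               ≡⟨ cong (_- (eX + eX)) split ⟩
    (eX + eX) + cut - (eX + eX)  ≡⟨ solve 2 (λ a c → a :+ c :- a := c) refl (eX + eX) cut ⟩
    cut ∎
    where
    eX≤ : eX ≤ p * x * x * ½ + δ ε * (n * p) * x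
    eX≤ = ≤-trans heX (+-monoʳ-≤ (p * x * x * ½) (*-monoʳ 0≤x hβ))
    δ-gap : 0ℚ ≤ ε * (+ 1 / 4096) - δ ε
    δ-gap = ≤⇒0≤- (δ≤ ε 0≤ε ε≤1)
    -- the (nonnegative) slack, written as a sum of visibly nonnegative terms
    margin : 0ℚ ≤ ε * (n' - (x + x)) * ½ + ε * (n - n') * ½
                  + n * (ε * (+ 1 / 4) - (ε * (+ 1 / 4096) + ε * (+ 1 / 4096)))
                  + (n * (ε * (+ 1 / 4096) - δ ε) + n * (ε * (+ 1 / 4096) - δ ε))
    margin = +-mono-≤ (+-mono-≤ (+-mono-≤ (0≤* (0≤* 0≤ε (≤⇒0≤- 2x≤n')) (decide≤ 0ℚ ½))
                                          (0≤* (0≤* 0≤ε (≤⇒0≤- n'≤n)) (decide≤ 0ℚ ½)))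
                                (0≤* 0≤n (subst (0ℚ ≤_) ε-part (0≤* 0≤ε (decide≤ 0ℚ (+ 1022 / 4096))))))
                      (+-mono-≤ (0≤* 0≤n δ-gap) (0≤* 0≤n δ-gap))
      where
      ε-part : ε * (+ 1022 / 4096) ≡ ε * (+ 1 / 4) - (ε * (+ 1 / 4096) + ε * (+ 1 / 4096))
      ε-part = solve 1 (λ ε → ε :* con (+ 1022 / 4096) := ε :* con (+ 1 / 4) :- (ε :* con (+ 1 / 4096) :+ ε :* con (+ 1 / 4096))) refl ε
    gap : p * x * (ε * (n' - (x + x)) * ½ + ε * (n - n') * ½
                   + n * (ε * (+ 1 / 4) - (ε * (+ 1 / 4096) + ε * (+ 1 / 4096)))
                   + (n * (ε * (+ 1 / 4096) - δ ε) + n * (ε * (+ 1 / 4096) - δ ε)))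
          ≡ x * ((1ℚ - (γ ε + γ ε)) * n * p) - ((p * x * x * ½ + δ ε * (n * p) * x) + (p * x * x * ½ + δ ε * (n * p) * x))
            - (1ℚ - ε) * p * x * (n - x)
    gap = solve 6 (λ ε n p x d n' →
            p :* x :* (ε :* (n' :- (x :+ x)) :* con ½ :+ ε :* (n :- n') :* con ½
                       :+ n :* (ε :* con (+ 1 / 4) :- (ε :* con (+ 1 / 4096) :+ ε :* con (+ 1 / 4096)))
                       :+ (n :* (ε :* con (+ 1 / 4096) :- d) :+ n :* (ε :* con (+ 1 / 4096) :- d)))
            := x :* ((con 1ℚ :- (ε :* con (+ 1 / 8) :+ ε :* con (+ 1 / 8))) :* n :* p)
               :- ((p :* x :* x :* con ½ :+ d :* (n :* p) :* x) :+ (p :* x :* x :* con ½ :+ d :* (n :* p) :* x))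
               :- (con 1ℚ :- ε) :* p :* x :* (n :- x)) refl ε n p x (δ ε) n'

module SumBounds where
  open import Data.Nat as ℕ using (ℕ; zero; suc)
  open import Data.Fin using (Fin; zero; suc)
  open import Data.Bool using (true; false; if_then_else_)
  open import Data.Rational
  open import Data.Rational.Properties
  open import Data.Rational.Solver using (module +-*-Solver)
  open import Relation.Binary.PropositionalEquality
  open Cast
  open +-*-Solver using (solve; con; _:+_; _:*_; _:-_; :-_; _:=_)
  open ≤-Reasoning

  ⟦suc-card⟧ : ∀ {n} (X : VSet (suc n)) → ⟦ suc (card (λ i → X (suc i))) ⟧ ≡ 1ℚ + ⟦ card (λ i → X (suc i)) ⟧
  ⟦suc-card⟧ X = trans (⟦⟧-+ 1 _) (cong (_+ ⟦ card (λ i → X (suc i)) ⟧) ⟦1⟧)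

  sum-lower : ∀ {n} (X : VSet n) (f : Fin n → ℕ) c → (∀ i → X i ≡ true → c ≤ ⟦ f i ⟧) →
    ⟦ card X ⟧ * c ≤ ⟦ sumFin (λ i → if X i then f i else 0) ⟧
  sum-lower {zero} X f c h = ≤-reflexive (trans (cong (_* c) ⟦0⟧) (trans (*-zeroˡ c) (sym ⟦0⟧)))
  sum-lower {suc n} X f c h with X zero | h zero
  ... | false | _ = sum-lower (λ i → X (suc i)) (λ i → f (suc i)) c (λ i → h (suc i))
  ... | true | h₀ = begin
    ⟦ suc k ⟧ * c            ≡⟨ cong (_* c) (⟦suc-card⟧ X) ⟩
    (1ℚ + ⟦ k ⟧) * c         ≡⟨ solve 2 (λ k c → (con 1ℚ :+ k) :* c := c :+ k :* c) refl ⟦ k ⟧ c ⟩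
    c + ⟦ k ⟧ * c            ≤⟨ +-mono-≤ (h₀ refl) (sum-lower (λ i → X (suc i)) (λ i → f (suc i)) c (λ i → h (suc i))) ⟩
    ⟦ f zero ⟧ + ⟦ rest ⟧    ≡⟨ sym (⟦⟧-+ (f zero) rest) ⟩
    ⟦ f zero ℕ.+ rest ⟧      ∎
    where
    k = card (λ i → X (suc i))
    rest = sumFin (λ i → if X (suc i) then f (suc i) else 0)

  sum-upper : ∀ {n} (X : VSet n) (f : Fin n → ℕ) c → (∀ i → X i ≡ true → ⟦ f i ⟧ ≤ c) →
    ⟦ sumFin (λ i → if X i then f i else 0) ⟧ ≤ ⟦ card X ⟧ * c
  sum-upper {zero} X f c h = ≤-reflexive (sym (trans (cong (_* c) ⟦0⟧) (trans (*-zeroˡ c) (sym ⟦0⟧))))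
  sum-upper {suc n} X f c h with X zero | h zero
  ... | false | _ = sum-upper (λ i → X (suc i)) (λ i → f (suc i)) c (λ i → h (suc i))
  ... | true | h₀ = begin
    ⟦ f zero ℕ.+ rest ⟧      ≡⟨ ⟦⟧-+ (f zero) rest ⟩
    ⟦ f zero ⟧ + ⟦ rest ⟧    ≤⟨ +-mono-≤ (h₀ refl) (sum-upper (λ i → X (suc i)) (λ i → f (suc i)) c (λ i → h (suc i))) ⟩
    c + ⟦ k ⟧ * c            ≡⟨ solve 2 (λ k c → c :+ k :* c := (con 1ℚ :+ k) :* c) refl ⟦ k ⟧ c ⟩
    (1ℚ + ⟦ k ⟧) * c         ≡⟨ cong (_* c) (sym (⟦suc-card⟧ X)) ⟩
    ⟦ suc k ⟧ * c            ∎
    where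
    k = card (λ i → X (suc i))
    rest = sumFin (λ i → if X (suc i) then f (suc i) else 0)

open import Data.Nat as ℕ using (ℕ) renaming (_≤_ to _≤ℕ_)
open import Data.Integer using (+_)
open import Data.Rational using (ℚ; _/_; _*_; _-_; _+_; _≤_; _<_; ∣_∣; ½; 0ℚ; 1ℚ)
open import Data.Bool using (true)
open import Data.Product using (Σ; _×_; ∃; _,_; proj₁; proj₂)
open import Relation.Binary.PropositionalEquality using (_≡_; subst; sym)

-- Jumbledness and the conclusion with the cast ℕ → ℚ as a parameter: for
-- ℕ→ℚ they unfold to Jumbled and GoodSubgraph; the construction uses ⟦_⟧.
Jumbled-via : (ℕ → ℚ) → ∀ {n} → Graph n → ℚ → ℚ → Set
Jumbled-via c G p β = ∀ X → ∣ c (eIn G X) - p * c (card X) * c (card X) * ½ ∣ ≤ β * c (card X)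

GoodSubgraph-via : (ℕ → ℚ) → ∀ {n} → Graph n → ℚ → ℚ → VSet n → Set
GoodSubgraph-via c {n} G p ε S =
  ((1ℚ - ε) * c n ≤ c (card S))
  × (∀ v → S v ≡ true →
       ((1ℚ - ε) * c (card S) * p ≤ c (degIn G S v)) × (c (degIn G S v) ≤ (1ℚ + ε) * c (card S) * p))
  × (∀ X → X ⊆ S → (1ℚ - ε) * p * c (card X) * c (card S ℕ.∸ card X) ≤ c (eBetween G X (S ∖ X)))

module Construction {n : ℕ} (G : Graph n) (p β ε : ℚ)
  (0<p : 0ℚ < p) (0<ε : 0ℚ < ε) (ε≤1 : ε ≤ 1ℚ) (0<n : 0ℚ < Cast.⟦ n ⟧)
  (n-large : 1ℚ ≤ ε * Cast.⟦ n ⟧ * (+ 1 / 32))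
  (hβ : β ≤ Calculations.δ ε * (Cast.⟦ n ⟧ * p)) (jumbled : Jumbled-via Cast.⟦_⟧ G p β) where

  open import Data.Fin using (Fin)
  open import Data.Fin.Properties using (any?)
  open import Data.Bool using (false; _∧_; _∨_; not; if_then_else_)
  import Data.Bool.Properties as BoolP
  open import Data.Rational hiding (floor; ceiling)
  open import Data.Rational.Properties
  open import Data.Rational.Solver using (module +-*-Solver)
  open import Relation.Binary.PropositionalEquality
  open import Relation.Nullary using (¬_; Dec; yes; no)
  open import Relation.Nullary.Decidable using (⌊_⌋; _×-dec_)
  open import Data.Product using (Σ; ∃; _,_; proj₁; proj₂)
  open import Data.Empty using (⊥-elim)
  import Data.Nat.Properties as ℕP
  open Counting
  open Counting.Edges G
  open Cast
  open SumBounds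
  open Calculations
  open +-*-Solver using (solve; con; _:+_; _:*_; _:-_; :-_; _:=_)
  open ≤-Reasoning

  nℚ : ℚ
  nℚ = ⟦ n ⟧

  edges-upper : ∀ X → ⟦ eIn G X ⟧ ≤ p * ⟦ card X ⟧ * ⟦ card X ⟧ * ½ + β * ⟦ card X ⟧
  edges-upper X = begin
    e                 ≡⟨ solve 2 (λ e q → e := (e :- q) :+ q) refl e q ⟩
    (e - q) + q       ≤⟨ +-monoˡ-≤ q (∣∣≤⇒≤ (jumbled X)) ⟩
    β * ⟦ card X ⟧ + q ≡⟨ +-comm _ q ⟩
    q + β * ⟦ card X ⟧ ∎
    where
    e = ⟦ eIn G X ⟧
    q = p * ⟦ card X ⟧ * ⟦ card X ⟧ * ½

  edges-lower : ∀ X → p * ⟦ card X ⟧ * ⟦ card X ⟧ * ½ - β * ⟦ card X ⟧ ≤ ⟦ eIn G X ⟧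
  edges-lower X = begin
    q - β * ⟦ card X ⟧   ≡⟨ +-comm q _ ⟩
    - (β * ⟦ card X ⟧) + q ≤⟨ +-monoˡ-≤ q (∣∣≤⇒≥- (jumbled X)) ⟩
    (e - q) + q          ≡⟨ solve 2 (λ e q → (e :- q) :+ q := e) refl e q ⟩
    e                    ∎
    where
    e = ⟦ eIn G X ⟧
    q = p * ⟦ card X ⟧ * ⟦ card X ⟧ * ½

  order-split : ∀ X → nℚ ≡ ⟦ card X ⟧ + ⟦ card (all ∖ X) ⟧
  order-split X = trans (cong ⟦_⟧ (trans (sym (card-all n)) (card-partition {n} {all} {X} (all-partition X))))
                        (⟦⟧-+ (card X) (card (all ∖ X)))

  ⟦complement⟧ : ∀ X → ⟦ eBetween G X all ⟧ + ⟦ eIn G (all ∖ X) ⟧ ≡ ⟦ eIn G all ⟧ + ⟦ eIn G X ⟧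
  ⟦complement⟧ X = trans (sym (⟦⟧-+ (eBetween G X all) (eIn G (all ∖ X))))
                         (trans (cong ⟦_⟧ (eBetween-complement X)) (⟦⟧-+ (eIn G all) (eIn G X)))

  degSum-upper : ∀ X → ⟦ eBetween G X all ⟧ ≤ p * ⟦ card X ⟧ * nℚ + (β * nℚ + β * nℚ)
  degSum-upper X =
    subst (λ m → ⟦ eBetween G X all ⟧ ≤ p * ⟦ card X ⟧ * m + (β * m + β * m)) (sym (order-split X))
      (degreeSum-upper p β ⟦ card X ⟧ ⟦ card (all ∖ X) ⟧ ⟦ eBetween G X all ⟧
                       ⟦ eIn G all ⟧ ⟦ eIn G X ⟧ ⟦ eIn G (all ∖ X) ⟧ (⟦complement⟧ X)
        (subst (λ m → ⟦ eIn G all ⟧ ≤ p * m * m * ½ + β * m) (trans (cong ⟦_⟧ (card-all n)) (order-split X))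
               (edges-upper all))
        (edges-upper X) (edges-lower (all ∖ X)))

  degSum-lower : ∀ X → p * ⟦ card X ⟧ * nℚ - (β * nℚ + β * nℚ) ≤ ⟦ eBetween G X all ⟧
  degSum-lower X =
    subst (λ m → p * ⟦ card X ⟧ * m - (β * m + β * m) ≤ ⟦ eBetween G X all ⟧) (sym (order-split X))
      (degreeSum-lower p β ⟦ card X ⟧ ⟦ card (all ∖ X) ⟧ ⟦ eBetween G X all ⟧
                       ⟦ eIn G all ⟧ ⟦ eIn G X ⟧ ⟦ eIn G (all ∖ X) ⟧ (⟦complement⟧ X)
        (subst (λ m → p * m * m * ½ - β * m ≤ ⟦ eIn G all ⟧) (trans (cong ⟦_⟧ (card-all n)) (order-split X))
               (edges-lower all))
        (edges-lower X) (edges-upper (all ∖ X)))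

  decided : ∀ {P : Set} (d : Dec P) → ⌊ d ⌋ ≡ true → P
  decided (yes p) _ = p

  refuted : ∀ {P : Set} (d : Dec P) → ⌊ d ⌋ ≡ false → ¬ P
  refuted (no ¬p) _ = ¬p

  deg : Fin n → ℕ
  deg v = degIn G all v

  High Low Abnormal : VSet n
  High v     = ⌊ (1ℚ + γ ε) * nℚ * p <? ⟦ deg v ⟧ ⌋
  Low v      = ⌊ ⟦ deg v ⟧ <? (1ℚ - γ ε) * nℚ * p ⌋
  Abnormal v = High v ∨ Low v

  ∨-false : ∀ {a b} → a ∨ b ≡ false → (a ≡ false) × (b ≡ false)
  ∨-false {false} {false} _ = refl , refl

  normal-high : ∀ v → Abnormal v ≡ false → ⟦ deg v ⟧ ≤ (1ℚ + γ ε) * nℚ * p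
  normal-high v h = ≮⇒≥ (refuted ((1ℚ + γ ε) * nℚ * p <? ⟦ deg v ⟧) (proj₁ (∨-false h)))

  normal-low : ∀ v → Abnormal v ≡ false → (1ℚ - γ ε) * nℚ * p ≤ ⟦ deg v ⟧
  normal-low v h = ≮⇒≥ (refuted (⟦ deg v ⟧ <? (1ℚ - γ ε) * nℚ * p) (proj₂ (∨-false h)))

  -- The degree sum of High exceeds p|High|n by γnp|High|, but by
  -- jumbledness it is within 2βn of p|High|n; so |High| ≤ κn/2.  Dually for Low.
  high-few : ⟦ card High ⟧ ≤ κ ε * nℚ * ½
  high-few = few-abnormal p β ε nℚ ⟦ card High ⟧ 0<p 0<ε 0<n hβ
    (excess-high p β ε nℚ ⟦ card High ⟧ ⟦ eBetween G High all ⟧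
      (subst (λ z → ⟦ card High ⟧ * ((1ℚ + γ ε) * nℚ * p) ≤ ⟦ z ⟧) (sym (eBetween-degSum High all))
        (sum-lower High deg _ (λ v h → <⇒≤ (decided ((1ℚ + γ ε) * nℚ * p <? ⟦ deg v ⟧) h))))
      (degSum-upper High))

  low-few : ⟦ card Low ⟧ ≤ κ ε * nℚ * ½
  low-few = few-abnormal p β ε nℚ ⟦ card Low ⟧ 0<p 0<ε 0<n hβ
    (excess-low p β ε nℚ ⟦ card Low ⟧ ⟦ eBetween G Low all ⟧ (degSum-lower Low)
      (subst (λ z → ⟦ z ⟧ ≤ ⟦ card Low ⟧ * ((1ℚ - γ ε) * nℚ * p)) (sym (eBetween-degSum Low all))
        (sum-upper Low deg _ (λ v h → <⇒≤ (decided (⟦ deg v ⟧ <? (1ℚ - γ ε) * nℚ * p) h)))))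

  abnormal-few : ⟦ card Abnormal ⟧ ≤ κ ε * nℚ
  abnormal-few = begin
    ⟦ card Abnormal ⟧                 ≤⟨ ⟦⟧-mono (card-∨ High Low) ⟩
    ⟦ card High ℕ.+ card Low ⟧        ≡⟨ ⟦⟧-+ (card High) (card Low) ⟩
    ⟦ card High ⟧ + ⟦ card Low ⟧      ≤⟨ +-mono-≤ high-few low-few ⟩
    κ ε * nℚ * ½ + κ ε * nℚ * ½       ≡⟨ solve 1 (λ a → a :* con ½ :+ a :* con ½ := a) refl (κ ε * nℚ) ⟩
    κ ε * nℚ                          ∎

  -- If every vertex of R ⊆ T has at least c neighbours in T, then
  -- |R|·c ≤ e(R,T) ≤ e(T,T) = 2e(T), which jumbledness bounds.
  heavy-inside : ∀ R T c → R ⊆ T → (∀ v → R v ≡ true → c ≤ ⟦ degIn G T v ⟧) →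
    ⟦ card R ⟧ * c ≤ (p * ⟦ card T ⟧ * ⟦ card T ⟧ * ½ + β * ⟦ card T ⟧)
                     + (p * ⟦ card T ⟧ * ⟦ card T ⟧ * ½ + β * ⟦ card T ⟧)
  heavy-inside R T c R⊆T heavy = begin
    ⟦ card R ⟧ * c                                   ≤⟨ sum-lower R (degIn G T) c heavy ⟩
    ⟦ sumFin (λ i → if R i then degIn G T i else 0) ⟧ ≡⟨ cong ⟦_⟧ (sym (eBetween-degSum R T)) ⟩
    ⟦ eBetween G R T ⟧                               ≤⟨ ⟦⟧-mono (eBetween-mono T R⊆T) ⟩
    ⟦ eBetween G T T ⟧                               ≡⟨ trans (cong ⟦_⟧ (eBetween-self T)) (⟦⟧-+ (eIn G T) (eIn G T)) ⟩
    ⟦ eIn G T ⟧ + ⟦ eIn G T ⟧                        ≤⟨ +-mono-≤ (edges-upper T) (edges-upper T) ⟩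
    (p * ⟦ card T ⟧ * ⟦ card T ⟧ * ½ + β * ⟦ card T ⟧) + (p * ⟦ card T ⟧ * ⟦ card T ⟧ * ½ + β * ⟦ card T ⟧) ∎

  -- The greedy deletion.  Start from S₀ = V ∖ Abnormal and repeatedly delete a
  -- vertex whose degree in G[S] is below the threshold (1-2γ)np.
  threshold : ℚ
  threshold = (1ℚ - (γ ε + γ ε)) * nℚ * p

  -- The vertices deleted so far.
  Removed : VSet n → VSet n
  Removed S = (all ∖ S) ∖ Abnormal

  record Invariant (S : VSet n) : Set where
    field
      avoids-abnormal : ∀ v → Abnormal v ≡ true → S v ≡ false
      removed-heavy   : ∀ v → Removed S v ≡ true → γ ε * nℚ * p ≤ ⟦ degIn G (all ∖ S) v ⟧
      removed-few     : ⟦ card (Removed S) ⟧ ≤ κ ε * nℚ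
  open Invariant

  Stable : VSet n → Set
  Stable S = ∀ v → S v ≡ true → threshold ≤ ⟦ degIn G S v ⟧

  S₀ : VSet n
  S₀ v = not (Abnormal v)

  invariant-initial : Invariant S₀
  invariant-initial = record
    { avoids-abnormal = λ v e → cong not e
    ; removed-heavy   = λ v e → ⊥-elim (true≢false (trans (sym e) (none-removed v)))
    ; removed-few     = subst (_≤ κ ε * nℚ) (trans (sym ⟦0⟧) (cong ⟦_⟧ (sym (sumFin-zero {n} λ v → cong ind (none-removed v)))))
                              (0≤* (0≤* (<⇒≤ 0<ε) (decide≤ 0ℚ (+ 1 / 128))) (<⇒≤ 0<n))
    }
    where
    true≢false : true ≢ false
    true≢false ()
    contradictory : ∀ b → not (not b) ∧ not b ≡ false
    contradictory true  = refl
    contradictory false = refl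
    none-removed : ∀ v → Removed S₀ v ≡ false
    none-removed v = contradictory (Abnormal v)

  member-normal : ∀ {S} → Invariant S → ∀ v → S v ≡ true → Abnormal v ≡ false
  member-normal inv v Sv = contrapositive (Abnormal v) (avoids-abnormal inv v) Sv

  -- Since v is normal, deg v ≥ (1-γ)np, while fewer than
  -- (1-2γ)np of its neighbours lie in S; so it has ≥ γnp neighbours outside.
  module Deletion (S : VSet n) (v : Fin n) (inv : Invariant S) (Sv : S v ≡ true)
                  (low : ⟦ degIn G S v ⟧ < threshold) where

    S' T' : VSet n
    S' = S ─ v
    T' = all ∖ S'

    deleted-heavy : γ ε * nℚ * p ≤ ⟦ degIn G T' v ⟧
    deleted-heavy = begin
      γ ε * nℚ * p
        ≡⟨ solve 3 (λ ε n p → (ε :* con (+ 1 / 8)) :* n :* p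
                              := (con 1ℚ :- ε :* con (+ 1 / 8)) :* n :* p :- (con 1ℚ :- (ε :* con (+ 1 / 8) :+ ε :* con (+ 1 / 8))) :* n :* p)
                   refl ε nℚ p ⟩
      (1ℚ - γ ε) * nℚ * p - threshold  ≤⟨ -‿mono (normal-low v (member-normal inv v Sv)) (<⇒≤ low) ⟩
      ⟦ deg v ⟧ - ⟦ degIn G S v ⟧      ≡⟨ cong (_- ⟦ degIn G S v ⟧) deg-split ⟩
      ⟦ degIn G S v ⟧ + ⟦ degIn G (all ∖ S) v ⟧ - ⟦ degIn G S v ⟧
        ≡⟨ solve 2 (λ a b → a :+ b :- a := b) refl ⟦ degIn G S v ⟧ ⟦ degIn G (all ∖ S) v ⟧ ⟩
      ⟦ degIn G (all ∖ S) v ⟧          ≤⟨ ⟦⟧-mono (degIn-mono v (complement-─ S v)) ⟩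
      ⟦ degIn G T' v ⟧                 ∎
      where
      deg-split : ⟦ deg v ⟧ ≡ ⟦ degIn G S v ⟧ + ⟦ degIn G (all ∖ S) v ⟧
      deg-split = trans (cong ⟦_⟧ (degIn-partition v (all-partition S))) (⟦⟧-+ _ _)

    still-avoids : ∀ u → Abnormal u ≡ true → S' u ≡ false
    still-avoids u e = cong (_∧ not (u =ᵛ v)) (avoids-abnormal inv u e)

    still-heavy : ∀ u → Removed S' u ≡ true → γ ε * nℚ * p ≤ ⟦ degIn G T' u ⟧
    still-heavy u h = by-cases (u =ᵛ v) refl
      where
      by-cases : ∀ b → u =ᵛ v ≡ b → γ ε * nℚ * p ≤ ⟦ degIn G T' u ⟧
      by-cases true  e = subst (λ w → γ ε * nℚ * p ≤ ⟦ degIn G T' w ⟧) (sym (=ᵛ-sound u v e)) deleted-heavy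
      by-cases false e = ≤-trans (removed-heavy inv u (outside-─ S Abnormal v u h e))
                                 (⟦⟧-mono (degIn-mono u (complement-─ S v)))

    -- The complement of S' consists of the abnormal and the deleted vertices;
    -- the latter are heavy inside it, so removed-bound applies.
    still-few : ⟦ card (Removed S') ⟧ ≤ κ ε * nℚ
    still-few = removed-bound p β ε nℚ r b 0<p 0<ε ε≤1 0<n n-large hβ (0≤⟦⟧ _) (0≤⟦⟧ _) abnormal-few one-more
      (subst (λ t → r * (γ ε * nℚ * p) ≤ (p * t * t * ½ + β * t) + (p * t * t * ½ + β * t)) T'-size
        (heavy-inside (Removed S') T' (γ ε * nℚ * p) (∖-⊆ T' Abnormal) still-heavy))
      where
      r b : ℚ
      r = ⟦ card (Removed S') ⟧
      b = ⟦ card Abnormal ⟧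
      abnormal⊆T' : Abnormal ⊆ T'
      abnormal⊆T' u e = cong not (still-avoids u e)
      T'-size : ⟦ card T' ⟧ ≡ b + r
      T'-size = trans (cong ⟦_⟧ (card-partition (⊆-partition abnormal⊆T'))) (⟦⟧-+ _ _)
      one-more : r ≤ κ ε * nℚ + 1ℚ
      one-more = begin
        r                                 ≤⟨ ⟦⟧-mono (card-outside-─ S Abnormal v) ⟩
        ⟦ card (Removed S) ℕ.+ 1 ⟧        ≡⟨ trans (⟦⟧-+ (card (Removed S)) 1) (cong (_+_ ⟦ card (Removed S) ⟧) ⟦1⟧) ⟩
        ⟦ card (Removed S) ⟧ + 1ℚ        ≤⟨ +-monoˡ-≤ 1ℚ (removed-few inv) ⟩
        κ ε * nℚ + 1ℚ                    ∎

    invariant-step : Invariant S'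
    invariant-step = record { avoids-abnormal = still-avoids ; removed-heavy = still-heavy ; removed-few = still-few }

  LowVertex : VSet n → Set
  LowVertex S = ∃ λ v → (S v ≡ true) × (⟦ degIn G S v ⟧ < threshold)

  lowVertex? : ∀ S → Dec (LowVertex S)
  lowVertex? S = any? (λ v → (S v BoolP.≟ true) ×-dec (⟦ degIn G S v ⟧ <? threshold))

  greedy : (k : ℕ) (S : VSet n) → card S ℕ.≤ k → Invariant S → Σ (VSet n) (λ T → Invariant T × Stable T)
  greedy-from : (k : ℕ) (S : VSet n) → card S ℕ.≤ k → Invariant S → Dec (LowVertex S) →
    Σ (VSet n) (λ T → Invariant T × Stable T)
  greedy k S |S|≤k inv = greedy-from k S |S|≤k inv (lowVertex? S)
  greedy-from k S |S|≤k inv (no none) = S , inv , λ v Sv → ≮⇒≥ (λ low → none (v , Sv , low))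
  greedy-from ℕ.zero S |S|≤0 inv (yes (v , Sv , low)) =
    ⊥-elim (ℕP.<⇒≱ (ℕP.≤-trans (ℕP.≤-reflexive (cong ind (sym Sv))) (term≤sumFin (λ u → ind (S u)) v)) |S|≤0)
  greedy-from (ℕ.suc k) S |S|≤1+k inv (yes (v , Sv , low)) =
    greedy k (S ─ v) (ℕP.+-cancelʳ-≤ 1 _ _ (subst (ℕ._≤ k ℕ.+ 1) (card-─ S v Sv) (subst (card S ℕ.≤_) (ℕP.+-comm 1 k) |S|≤1+k)))
           (Deletion.invariant-step S v inv Sv low)

  -- The final set: the result of the deletion process from S₀.  It is kept
  -- opaque so that its (long) computation is never unfolded.
  opaque
    Final : VSet n
    Final = proj₁ (greedy n S₀ (card≤n S₀) invariant-initial)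

    final-invariant : Invariant Final
    final-invariant = proj₁ (proj₂ (greedy n S₀ (card≤n S₀) invariant-initial))

    final-stable : Stable Final
    final-stable = proj₂ (proj₂ (greedy n S₀ (card≤n S₀) invariant-initial))

  n' b r : ℚ
  n' = ⟦ card Final ⟧
  b  = ⟦ card Abnormal ⟧
  r  = ⟦ card (Removed Final) ⟧

  order-decomposition : n' + (b + r) ≡ nℚ
  order-decomposition = sym (trans (order-split Final) (cong (_+_ n') outside))
    where
    abnormal-outside : Abnormal ⊆ (all ∖ Final)
    abnormal-outside u e = cong not (avoids-abnormal final-invariant u e)
    outside : ⟦ card (all ∖ Final) ⟧ ≡ b + r
    outside = trans (cong ⟦_⟧ (card-partition (⊆-partition abnormal-outside))) (⟦⟧-+ _ _)

  final≤n : n' ≤ nℚ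
  final≤n = begin
    n'            ≡⟨ sym (+-identityʳ n') ⟩
    n' + 0ℚ       ≤⟨ +-monoʳ-≤ n' (+-mono-≤ (0≤⟦⟧ (card Abnormal)) (0≤⟦⟧ (card (Removed Final)))) ⟩
    n' + (b + r)  ≡⟨ order-decomposition ⟩
    nℚ            ∎

  final-order : (1ℚ - ε) * nℚ ≤ n'
  final-order = order-bound ε nℚ n' b r (<⇒≤ 0<ε) (<⇒≤ 0<n) order-decomposition abnormal-few
                  (removed-few final-invariant)

  -- Degrees in G[Final]: at least the threshold by stability, and at most the
  -- degree in G, which is at most (1+γ)np since Final avoids Abnormal.
  final-degrees : ∀ v → Final v ≡ true →
    ((1ℚ - ε) * n' * p ≤ ⟦ degIn G Final v ⟧) × (⟦ degIn G Final v ⟧ ≤ (1ℚ + ε) * n' * p)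
  final-degrees v Fv =
    minDegree-bound ε nℚ n' p _ (<⇒≤ 0<ε) ε≤1 (<⇒≤ 0<p) (<⇒≤ 0<n) final≤n (final-stable v Fv) ,
    maxDegree-bound ε nℚ n' p b r _ (<⇒≤ 0<ε) ε≤1 (<⇒≤ 0<p) (<⇒≤ 0<n) order-decomposition abnormal-few
      (removed-few final-invariant)
      (≤-trans (⟦⟧-mono (degIn-mono v {Final} {all} (λ _ _ → refl))) (normal-high v (member-normal final-invariant v Fv)))

  -- Cuts of sets X with |X| ≤ |Final|/2: e(X,Final) ≥ |X|·threshold by
  -- stability, and e(X,Final) = 2e(X) + e(X, Final∖X).
  small-cut : ∀ X → X ⊆ Final → card X ℕ.+ card X ℕ.≤ card Final →
    (1ℚ - ε) * p * ⟦ card X ⟧ * ⟦ card Final ℕ.∸ card X ⟧ ≤ ⟦ eBetween G X (Final ∖ X) ⟧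
  small-cut X X⊆F 2x≤n' =
    subst (λ z → (1ℚ - ε) * p * ⟦ card X ⟧ * z ≤ ⟦ eBetween G X (Final ∖ X) ⟧)
          (sym (⟦⟧-∸ (card Final) (card X) (ℕP.≤-trans (ℕP.m≤m+n (card X) (card X)) 2x≤n')))
      (smallCut-bound ε nℚ n' p β ⟦ card X ⟧ ⟦ eBetween G X Final ⟧ ⟦ eIn G X ⟧ ⟦ eBetween G X (Final ∖ X) ⟧
        (<⇒≤ 0<ε) ε≤1 (<⇒≤ 0<p) (<⇒≤ 0<n) (0≤⟦⟧ (card X))
        (subst (_≤ n') (⟦⟧-+ (card X) (card X)) (⟦⟧-mono 2x≤n')) final≤n hβ
        (subst (λ z → ⟦ card X ⟧ * threshold ≤ ⟦ z ⟧) (sym (eBetween-degSum X Final))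
               (sum-lower X (degIn G Final) threshold (λ i Xi → final-stable i (X⊆F i Xi))))
        (trans (cong ⟦_⟧ (eBetween-sub X⊆F))
               (trans (⟦⟧-+ (eIn G X ℕ.+ eIn G X) _) (cong (_+ ⟦ eBetween G X (Final ∖ X) ⟧) (⟦⟧-+ (eIn G X) (eIn G X)))))
        (edges-upper X))

  -- A larger X is handled through its complement Y = Final ∖ X, which has the
  -- same cut and the symmetric bound.
  final-cuts : ∀ X → X ⊆ Final →
    (1ℚ - ε) * p * ⟦ card X ⟧ * ⟦ card Final ℕ.∸ card X ⟧ ≤ ⟦ eBetween G X (Final ∖ X) ⟧
  final-cuts X X⊆F = by-size (card X ℕ.+ card X ℕ.≤? card Final)
    where
    Y = Final ∖ X
    x = card X
    y = card Y
    F-split : card Final ≡ x ℕ.+ y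
    F-split = card-partition (⊆-partition X⊆F)
    by-size : Dec (x ℕ.+ x ℕ.≤ card Final) →
      (1ℚ - ε) * p * ⟦ x ⟧ * ⟦ card Final ℕ.∸ x ⟧ ≤ ⟦ eBetween G X Y ⟧
    by-size (yes small) = small-cut X X⊆F small
    by-size (no large) = begin
      (1ℚ - ε) * p * ⟦ x ⟧ * ⟦ card Final ℕ.∸ x ⟧
        ≡⟨ cong₂ (λ a c → (1ℚ - ε) * p * ⟦ a ⟧ * ⟦ c ⟧) (sym rest-of-Y) rest-of-X ⟩
      (1ℚ - ε) * p * ⟦ card Final ℕ.∸ y ⟧ * ⟦ y ⟧
        ≡⟨ solve 4 (λ a p u w → a :* p :* u :* w := a :* p :* w :* u) refl (1ℚ - ε) p ⟦ card Final ℕ.∸ y ⟧ ⟦ y ⟧ ⟩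
      (1ℚ - ε) * p * ⟦ y ⟧ * ⟦ card Final ℕ.∸ y ⟧
        ≤⟨ small-cut Y (∖-⊆ Final X) Y-small ⟩
      ⟦ eBetween G Y (Final ∖ Y) ⟧
        ≡⟨ cong ⟦_⟧ (trans (eBetween-congʳ Y (∖-involutive X⊆F)) (eBetween-comm Y X)) ⟩
      ⟦ eBetween G X Y ⟧ ∎
      where
      rest-of-X : card Final ℕ.∸ x ≡ y
      rest-of-X = trans (cong (ℕ._∸ x) F-split) (ℕP.m+n∸m≡n x y)
      rest-of-Y : card Final ℕ.∸ y ≡ x
      rest-of-Y = trans (cong (ℕ._∸ y) F-split) (ℕP.m+n∸n≡m x y)
      Y-small : y ℕ.+ y ℕ.≤ card Final
      Y-small = subst (y ℕ.+ y ℕ.≤_) (sym F-split)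
                  (ℕP.+-monoˡ-≤ y (ℕP.<⇒≤ (ℕP.≰⇒> (λ x≤y → large (subst (x ℕ.+ x ℕ.≤_) (sym F-split) (ℕP.+-monoʳ-≤ x x≤y))))))

  final-good : GoodSubgraph-via ⟦_⟧ G p ε Final
  final-good = final-order , final-degrees , final-cuts

-- The degenerate case p ≤ 0 (then also β ≤ 0): jumbledness applied to V gives
-- e(V) = pn²/2 ≤ 0, so p = 0 and G has no edges; V itself is then good.
module Degenerate {n : ℕ} (G : Graph n) (p β ε : ℚ) (0<ε : 0ℚ < ε) (0<n : 0ℚ < Cast.⟦ n ⟧)
  (p≤0 : p ≤ 0ℚ) (β≤0 : β ≤ 0ℚ) (jumbled : Jumbled-via Cast.⟦_⟧ G p β) where

  open import Data.Empty using (⊥-elim)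
  import Data.Nat.Properties as ℕP
  open import Data.Rational.Properties
  open import Data.Rational.Solver using (module +-*-Solver)
  open import Relation.Binary.PropositionalEquality
  open Counting
  open Counting.Edges G
  open Cast
  open Calculations using (decide<)
  open +-*-Solver using (solve; con; _:+_; _:*_; _:-_; :-_; _:=_)

  c : ℚ
  c = ⟦ card (all {n}) ⟧

  0<c²/2 : 0ℚ < c * c * ½
  0<c²/2 = 0<* (0<* c-pos c-pos) (decide< 0ℚ ½)
    where
    c-pos : 0ℚ < c
    c-pos = subst (λ m → 0ℚ < ⟦ m ⟧) (sym (card-all n)) 0<n

  edges-exact : ⟦ eIn G all ⟧ ≡ c * c * ½ * p
  edges-exact = begin
    ⟦ eIn G all ⟧                  ≡⟨ solve 2 (λ e q → e := (e :- q) :+ q) refl ⟦ eIn G all ⟧ q ⟩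
    (⟦ eIn G all ⟧ - q) + q        ≡⟨ cong (_+ q) deviation-zero ⟩
    0ℚ + q                         ≡⟨ solve 2 (λ p c → con 0ℚ :+ p :* c :* c :* con ½ := c :* c :* con ½ :* p) refl p c ⟩
    c * c * ½ * p                  ∎
    where
    open ≡-Reasoning
    q = p * c * c * ½
    deviation-zero : ⟦ eIn G all ⟧ - q ≡ 0ℚ
    deviation-zero = ∣p∣≡0⇒p≡0 _ (≤-antisym (≤-trans (jumbled all) (≤-trans (*-monoʳ (0≤⟦⟧ _) β≤0)
                                                                                  (≤-reflexive (*-zeroˡ c))))
                                            (0≤∣p∣ _))

  p≡0 : p ≡ 0ℚ
  p≡0 = ≤-antisym p≤0 (*-cancelˡ 0<c²/2 (subst (_≤ c * c * ½ * p) (sym (*-zeroʳ (c * c * ½)))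
                                                 (subst (0ℚ ≤_) edges-exact (0≤⟦⟧ (eIn G all)))))

  no-edges : eIn G all ≡ 0
  no-edges = ⟦⟧≤0 (eIn G all) (subst (_≤ 0ℚ) (sym edges-exact)
                     (≤-trans (*-monoˡ (<⇒≤ 0<c²/2) p≤0) (≤-reflexive (*-zeroʳ (c * c * ½)))))
    where
    ⟦⟧≤0 : ∀ a → ⟦ a ⟧ ≤ 0ℚ → a ≡ 0
    ⟦⟧≤0 ℕ.zero    _ = refl
    ⟦⟧≤0 (ℕ.suc a) h = ⊥-elim (<-irrefl refl (<-≤-trans (decide< 0ℚ 1ℚ)
                                 (≤-trans (≤-reflexive (sym ⟦1⟧)) (≤-trans (⟦⟧-mono (ℕ.s≤s (ℕ.z≤n {a}))) h))))

  -- Every degree is bounded by the degree sum 2e(V) = 0.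
  no-degree : ∀ v → degIn G all v ≡ 0
  no-degree v = ℕP.n≤0⇒n≡0 (ℕP.≤-trans (term≤sumFin (λ i → degIn G all i) v)
    (ℕP.≤-reflexive (trans (sym (eBetween-degSum all all)) (trans (eBetween-self all) (cong₂ ℕ._+_ no-edges no-edges)))))

  all-good : GoodSubgraph-via ⟦_⟧ G p ε all
  all-good = subst (λ q → GoodSubgraph-via ⟦_⟧ G q ε all) (sym p≡0) edgeless-good
    where
    edgeless-good : GoodSubgraph-via ⟦_⟧ G 0ℚ ε all
    edgeless-good =
      ≤-trans (0≤-⇒≤ (subst (0ℚ ≤_) (solve 2 (λ e n → e :* n := n :- (con 1ℚ :- e) :* n) refl ε ⟦ n ⟧)
                                     (0≤* (<⇒≤ 0<ε) (<⇒≤ 0<n))))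
              (≤-reflexive (cong ⟦_⟧ (sym (card-all n)))) ,
      (λ v _ → ≤-trans (≤-reflexive (*-zeroʳ ((1ℚ - ε) * c))) (0≤⟦⟧ (degIn G all v)) ,
               ≤-reflexive (trans (cong ⟦_⟧ (no-degree v)) (trans ⟦0⟧ (sym (*-zeroʳ ((1ℚ + ε) * c)))))) ,
      (λ X _ → ≤-trans (≤-reflexive (solve 3 (λ e x y → (con 1ℚ :- e) :* con 0ℚ :* x :* y := con 0ℚ) refl
                                            ε ⟦ card X ⟧ ⟦ card (all {n}) ℕ.∸ card X ⟧))
                       (0≤⟦⟧ (eBetween G X (all ∖ X))))

good-mono : ∀ {n} (G : Graph n) p e ε S → e ≤ ε → 0ℚ ≤ p →
  GoodSubgraph-via Cast.⟦_⟧ G p e S → GoodSubgraph-via Cast.⟦_⟧ G p ε S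
good-mono {n} G p e ε S e≤ε 0≤p (order , degrees , cuts) =
  ≤-trans (*-monoʳ (0≤⟦⟧ n) 1-ε≤1-e) order ,
  (λ v Sv → ≤-trans (*-monoʳ 0≤p (*-monoʳ (0≤⟦⟧ (card S)) 1-ε≤1-e)) (proj₁ (degrees v Sv)) ,
            ≤-trans (proj₂ (degrees v Sv)) (*-monoʳ 0≤p (*-monoʳ (0≤⟦⟧ (card S)) (+-monoʳ-≤ 1ℚ e≤ε)))) ,
  (λ X X⊆S → ≤-trans (*-monoʳ (0≤⟦⟧ _) (*-monoʳ (0≤⟦⟧ (card X)) (*-monoʳ 0≤p 1-ε≤1-e))) (cuts X X⊆S))
  where
  open import Data.Rational.Properties using (≤-trans; +-monoʳ-≤; ≤-refl)
  open Cast
  1-ε≤1-e : 1ℚ - ε ≤ 1ℚ - e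
  1-ε≤1-e = -‿mono (≤-refl {1ℚ}) e≤ε

good-subgraph-exists : ∀ {n} (G : Graph n) p β e ε → 0ℚ < e → e ≤ 1ℚ → e ≤ ε →
  0ℚ < Cast.⟦ n ⟧ → 1ℚ ≤ e * Cast.⟦ n ⟧ * (+ 1 / 32) → β ≤ Calculations.δ e * (Cast.⟦ n ⟧ * p) →
  Jumbled-via Cast.⟦_⟧ G p β → ∃ λ S → GoodSubgraph-via Cast.⟦_⟧ G p ε S
good-subgraph-exists {n} G p β e ε 0<e e≤1 e≤ε 0<n n-large hβ jumbled = by-sign (0ℚ <? p)
  where
  open import Data.Rational.Properties
  open import Relation.Nullary using (Dec; yes; no)
  open Cast
  open Calculations using (δ; decide≤)
  by-sign : Dec (0ℚ < p) → ∃ λ S → GoodSubgraph-via ⟦_⟧ G p ε S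
  by-sign (yes 0<p) = Final , good-mono G p e ε Final e≤ε (<⇒≤ 0<p) final-good
    where open Construction G p β e 0<p 0<e e≤1 0<n n-large hβ jumbled
  by-sign (no p≯0) = Counting.all , Degenerate.all-good G p β ε (<-≤-trans 0<e e≤ε) 0<n p≤0 β≤0 jumbled
    where
    p≤0 : p ≤ 0ℚ
    p≤0 = ≮⇒≥ p≯0
    β≤0 : β ≤ 0ℚ
    β≤0 = ≤-trans hβ (≤-trans (*-monoˡ (0≤* (0≤* 0≤e 0≤e) (decide≤ 0ℚ (+ 1 / 4096)))
                                       (≤-trans (*-monoˡ (0≤⟦⟧ n) p≤0) (≤-reflexive (*-zeroʳ ⟦ n ⟧))))
                              (≤-reflexive (*-zeroʳ (δ e))))
      where
      0≤e : 0ℚ ≤ e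
      0≤e = <⇒≤ 0<e

large-orders : (p β : ℕ → ℚ) → (∀ δ → 0ℚ < δ → ∃ λ N → ∀ n → N ≤ℕ n → β n ≤ δ * (ℕ→ℚ n * p n)) →
  ∀ e → 0ℚ < e → ∃ λ N → ∀ n → N ≤ℕ n →
    (0ℚ < Cast.⟦ n ⟧) × (1ℚ ≤ e * Cast.⟦ n ⟧ * (+ 1 / 32)) × (β n ≤ Calculations.δ e * (Cast.⟦ n ⟧ * p n))
large-orders p β β-small e 0<e = N₁ ℕ.⊔ (N₂ ℕ.⊔ 1) , bounds
  where
  import Data.Nat.Properties as ℕP
  open import Data.Rational.Properties
  open import Data.Rational.Solver using (module +-*-Solver)
  open import Relation.Binary.PropositionalEquality
  open Cast
  open Calculations using (δ; decide<)
  open +-*-Solver using (solve; con; _:*_; _:=_)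
  0<δ : 0ℚ < δ e
  0<δ = 0<* (0<* 0<e 0<e) (decide< 0ℚ (+ 1 / 4096))
  0<e/32 : 0ℚ < e * (+ 1 / 32)
  0<e/32 = 0<* 0<e (decide< 0ℚ (+ 1 / 32))
  N₁ N₂ : ℕ
  N₁ = proj₁ (β-small (δ e) 0<δ)
  N₂ = Data.Rational.↧ₙ (e * (+ 1 / 32))
  bounds : ∀ n → N₁ ℕ.⊔ (N₂ ℕ.⊔ 1) ≤ℕ n →
    (0ℚ < ⟦ n ⟧) × (1ℚ ≤ e * ⟦ n ⟧ * (+ 1 / 32)) × (β n ≤ δ e * (⟦ n ⟧ * p n))
  bounds n N≤n =
    <-≤-trans (decide< 0ℚ 1ℚ) (≤-trans (≤-reflexive (sym ⟦1⟧)) (⟦⟧-mono (ℕP.≤-trans (ℕP.m≤n⊔m N₂ 1) N₂⊔1≤n))) ,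
    subst (λ c → 1ℚ ≤ e * c n * (+ 1 / 32)) (sym ⟦⟧≡ℕ→ℚ)
      (≤-trans (archimedean (e * (+ 1 / 32)) 0<e/32 n (ℕP.≤-trans (ℕP.m≤m⊔n N₂ 1) N₂⊔1≤n))
               (≤-reflexive (solve 2 (λ e n → e :* con (+ 1 / 32) :* n := e :* n :* con (+ 1 / 32)) refl e (ℕ→ℚ n)))) ,
    subst (λ c → β n ≤ δ e * (c n * p n)) (sym ⟦⟧≡ℕ→ℚ)
      (proj₂ (β-small (δ e) 0<δ) n (ℕP.≤-trans (ℕP.m≤m⊔n N₁ _) N≤n))
    where
    N₂⊔1≤n : N₂ ℕ.⊔ 1 ≤ℕ n
    N₂⊔1≤n = ℕP.≤-trans (ℕP.m≤n⊔m N₁ _) N≤n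

capped : ∀ ε → 0ℚ < ε → Σ ℚ λ e → (0ℚ < e) × (e ≤ 1ℚ) × (e ≤ ε)
capped ε 0<ε = ε ⊓ 1ℚ , [ (λ e≡ε → subst (0ℚ <_) (sym e≡ε) 0<ε) , (λ e≡1 → subst (0ℚ <_) (sym e≡1) (decide< 0ℚ 1ℚ)) ]′ (⊓-sel ε 1ℚ)
                      , p⊓q≤q ε 1ℚ , p⊓q≤p ε 1ℚ
  where
  open import Data.Rational using (_⊓_)
  open import Data.Rational.Properties using (p⊓q≤p; p⊓q≤q; ⊓-sel)
  open import Data.Sum using ([_,_]′)
  open Calculations using (decide<)

lemma6p1 : (p β : ℕ → ℚ)
    → (∀ δ → 0ℚ < δ → ∃ λ N → ∀ n → N ≤ℕ n → β n ≤ δ * (ℕ→ℚ n * p n))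
    → ∀ ε → 0ℚ < ε → ∃ λ N → ∀ n → N ≤ℕ n → (G : Graph n)
    → Jumbled G (p n) (β n)
    → ∃ λ (S : VSet n) → GoodSubgraph G (p n) ε S
lemma6p1 p β β-small ε 0<ε =
  let (e , 0<e , e≤1 , e≤ε) = capped ε 0<ε
      (N , bounds)          = large-orders p β β-small e 0<e
  in N , λ n N≤n G jumbled →
    let (0<n , n-large , hβ) = bounds n N≤n
        -- Jumbled and GoodSubgraph are the ⟦_⟧-versions at the cast ℕ→ℚ
        (S , good) = good-subgraph-exists G (p n) (β n) e ε 0<e e≤1 e≤ε 0<n n-large hβ
                       (subst (λ c → Jumbled-via c G (p n) (β n)) (sym Cast.⟦⟧≡ℕ→ℚ) jumbled)
    in S , subst (λ c → GoodSubgraph-via c G (p n) ε S) Cast.⟦⟧≡ℕ→ℚ good
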